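{- Let $\mathcal{A}$ be an addable minor-closed class of graphs. Then: (a) $\beta_{\mathcal{A}} = \sup\{\rho_1(G): G\in\mathcal{A}\}$; (b) if $K_3\notin\mathcal{A}$, then $\mathcal{A}$ is the class of forests, $\beta_{\mathcal{A}}=1$, and $\rho_1(T)=1$ for each connected graph (tree) $T\in\mathcal{A}$ with at least one edge; (c) if $K_3\in\mathcal{A}$, then $\beta_{\mathcal{A}} = \sup\{\rho_1(G): G\in\mathcal{A},\ G \text{ is } 2\text{ -connected}\}$.
   Context: All graphs are finite and simple. A class is minor-closed if it contains all minors of its members. $\beta_{\mathcal{A}}=\sup_{G\in\mathcal{A}} e(G)/v(G)$. The $1$-density is $\rho_1(G)=e(G)/(v(G)-1)$ if $e(G)>0$, and $\rho_1(G)=0$ otherwise. A class $\mathcal{A}$ is decomposable if a graph is in $\mathcal{A}$ iff each of its components is; bridge-addable if for any $G\in\mathcal{A}$ and vertices $u,v$ in different components of $G$, the graph $G+uv$ is in $\mathcal{A}$; and addable if it is both decomposable and bridge-addable. -}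

module Defs where

open import Data.Nat as ℕ using (ℕ; zero; suc; _<ᵇ_)
open import Data.Integer using (+_)
open import Data.Rational using (ℚ; 0ℚ; 1ℚ; _≤_; _<_) renaming (_/_ to _÷_)
open import Data.Fin using (Fin; toℕ; inject₁; fromℕ) renaming (zero to fzero; suc to fsuc)
open import Data.Fin.Properties using (_≟_)
open import Data.Bool using (Bool; true; false; _∧_; _∨_; if_then_else_; not)
open import Data.List using (List; map; allFin)
open import Data.Nat.ListAction using (sum)
open import Data.Product using (Σ; ∃; ∃-syntax; _×_; _,_)
open import Data.Unit using (⊤)
open import Data.Empty using (⊥)
open import Relation.Nullary using (¬_; yes; no)
open import Relation.Nullary.Decidable using (⌊_⌋)
open import Relation.Binary.PropositionalEquality using (_≡_; refl; sym; cong₂; cong)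
open import Function.Definitions using (Injective)

record Graph : Set where
  field
    n      : ℕ
    adj    : Fin n → Fin n → Bool
    adj-sym   : ∀ i j → adj i j ≡ adj j i
    adj-irrefl : ∀ i → adj i i ≡ false
open Graph public

v : Graph → ℕ
v G = n G

e : Graph → ℕ
e G = sum (map (λ i → sum (map (λ j → if (adj G i j ∧ (toℕ i <ᵇ toℕ j)) then 1 else 0)
                                (allFin (n G))))
               (allFin (n G)))

Class : Set₁
Class = Graph → Set

data Reach (G : Graph) (S : Fin (n G) → Set) (u : Fin (n G)) : Fin (n G) → Set where
  here : S u → Reach G S u u
  step : ∀ {w x} → Reach G S u w → adj G w x ≡ true → S x → Reach G S u x

SameComponent : (G : Graph) → Fin (n G) → Fin (n G) → Set
SameComponent G = Reach G (λ _ → ⊤)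

Connected : Graph → Set
Connected G = ∀ x y → SameComponent G x y

TwoConnected : Graph → Set
TwoConnected G =
  (3 ℕ.≤ n G) × Connected G ×
  (∀ z x y → ¬ x ≡ z → ¬ y ≡ z → Reach G (λ w → ¬ w ≡ z) x y)

-- Minors (via branch-set models)

_≼_ : Graph → Graph → Set
H ≼ G = Σ (Fin (n H) → Fin (n G) → Bool) λ φ →
    (∀ h → ∃[ x ] φ h x ≡ true)
  × (∀ h h' x → φ h x ≡ true → φ h' x ≡ true → h ≡ h')
  × (∀ h x y → φ h x ≡ true → φ h y ≡ true → Reach G (λ w → φ h w ≡ true) x y)
  × (∀ h h' → adj H h h' ≡ true →
       ∃[ x ] ∃[ y ] (φ h x ≡ true × φ h' y ≡ true × adj G x y ≡ true))

MinorClosed : Class → Set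
MinorClosed A = ∀ G H → A G → H ≼ G → A H

induced : (G : Graph) {m : ℕ} → (Fin m → Fin (n G)) → Graph
induced G {m} f = record
  { n = m
  ; adj = λ i j → adj G (f i) (f j)
  ; adj-sym = λ i j → adj-sym G (f i) (f j)
  ; adj-irrefl = λ i → adj-irrefl G (f i) }

IsComponent : (G : Graph) {m : ℕ} → (Fin m → Fin (n G)) → Set
IsComponent G {m} f =
    (1 ℕ.≤ m)
  × Injective _≡_ _≡_ f
  × (∀ i j → SameComponent G (f i) (f j))
  × (∀ i x → SameComponent G (f i) x → ∃[ j ] f j ≡ x)

Decomposable : Class → Set
Decomposable A = ∀ G →
  (A G → ∀ m (f : Fin m → Fin (n G)) → IsComponent G f → A (induced G f))
  × ((∀ m (f : Fin m → Fin (n G)) → IsComponent G f → A (induced G f)) → A G)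

private
  eqb : ∀ {k} → Fin k → Fin k → Bool
  eqb i j = ⌊ i ≟ j ⌋

  eqb-sym : ∀ {k} (i j : Fin k) → eqb i j ≡ eqb j i
  eqb-sym i j with i ≟ j | j ≟ i
  ... | yes _ | yes _ = refl
  ... | no _  | no _  = refl
  ... | yes p | no q  with q (sym p)
  ... | ()
  eqb-sym i j | no p | yes q with p (sym q)
  ... | ()

  new : ∀ {k} → Fin k → Fin k → Fin k → Fin k → Bool
  new u w i j = (eqb i u ∧ eqb j w) ∨ (eqb i w ∧ eqb j u)

  swap4 : ∀ a b c d → ((a ∧ b) ∨ (c ∧ d)) ≡ ((d ∧ c) ∨ (b ∧ a))
  swap4 false false c d with c | d
  ... | false | false = refl
  ... | false | true = refl
  ... | true | false = refl
  ... | true | true = refl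
  swap4 false true c d with c | d
  ... | false | false = refl
  ... | false | true = refl
  ... | true | false = refl
  ... | true | true = refl
  swap4 true false c d with c | d
  ... | false | false = refl
  ... | false | true = refl
  ... | true | false = refl
  ... | true | true = refl
  swap4 true true c d with c | d
  ... | false | false = refl
  ... | false | true = refl
  ... | true | false = refl
  ... | true | true = refl

  new-sym : ∀ {k} (u w i j : Fin k) → new u w i j ≡ new u w j i
  new-sym u w i j = swap4 (eqb i u) (eqb j w) (eqb i w) (eqb j u)

  new-irrefl : ∀ {k} (u w i : Fin k) → ¬ u ≡ w → new u w i i ≡ false
  new-irrefl u w i u≢w with i ≟ u | i ≟ w
  ... | no _  | no _  = refl
  ... | no _  | yes _ = refl
  ... | yes _ | no _  = refl
  ... | yes refl | yes refl with u≢w refl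
  ... | ()

  or-false : ∀ a b → a ≡ false → b ≡ false → (a ∨ b) ≡ false
  or-false false false refl refl = refl

addEdge : (G : Graph) (u w : Fin (n G)) → ¬ u ≡ w → Graph
addEdge G u w u≢w = record
  { n = n G
  ; adj = λ i j → adj G i j ∨ new u w i j
  ; adj-sym = λ i j → cong₂ _∨_ (adj-sym G i j) (new-sym u w i j)
  ; adj-irrefl = λ i → or-false _ _ (adj-irrefl G i) (new-irrefl u w i u≢w) }

diffComp⇒≢ : (G : Graph) (u w : Fin (n G)) → ¬ SameComponent G u w → ¬ u ≡ w
diffComp⇒≢ G u .u nc refl = nc (here _)

BridgeAddable : Class → Set
BridgeAddable A = ∀ G u w → A G → (nc : ¬ SameComponent G u w) →
  A (addEdge G u w (diffComp⇒≢ G u w nc))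

Addable : Class → Set
Addable A = Decomposable A × BridgeAddable A

K : ℕ → Graph
K m = record
  { n = m
  ; adj = λ i j → not (eqb i j)
  ; adj-sym = λ i j → cong not (eqb-sym i j)
  ; adj-irrefl = λ i → irr i }
  where
  irr : ∀ i → not (eqb i i) ≡ false
  irr i with i ≟ i
  ... | yes _ = refl
  ... | no p with p refl
  ... | ()

HasCycle : Graph → Set
HasCycle G = ∃[ k ] Σ (Fin (suc (suc (suc k))) → Fin (n G)) λ c →
    Injective _≡_ _≡_ c
  × (∀ (i : Fin (suc (suc k))) → adj G (c (inject₁ i)) (c (fsuc i)) ≡ true)
  × (adj G (c (fromℕ (suc (suc k)))) (c fzero) ≡ true)

Forest : Graph → Set
Forest G = ¬ HasCycle G

-- e(G)/v(G)  (for v(G) = 0 we use the value 0; it never matters below)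
density : Graph → ℚ
density G with n G
... | zero  = 0ℚ
... | suc k = (+ e G) ÷ suc k

-- 1-density ρ₁(G) = e(G)/(v(G)-1) if e(G) > 0, and 0 otherwise
-- (when v(G) ≤ 1 we necessarily have e(G) = 0)
ρ₁ : Graph → ℚ
ρ₁ G with n G | e G
... | zero        | _     = 0ℚ
... | suc zero    | _     = 0ℚ
... | suc (suc k) | zero  = 0ℚ
... | suc (suc k) | suc m = (+ suc m) ÷ suc k

-- Suprema over a class, expressed without reals.
-- sup {f G : G ∈ A, P G} = sup {g G : G ∈ A, Q G}  (in the extended reals)
-- iff both sets have the same rational upper bounds.

UpperBound : (A : Graph → Set) → (Graph → ℚ) → ℚ → Set
UpperBound A f q = ∀ G → A G → f G ≤ q

SameSup : (A B : Graph → Set) (f g : Graph → ℚ) → Set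
SameSup A B f g = ∀ q → (UpperBound A f q → UpperBound B g q) × (UpperBound B g q → UpperBound A f q)

IsSup : (A : Graph → Set) → (Graph → ℚ) → ℚ → Set
IsSup A f s = UpperBound A f s × (∀ q → q < s → ∃[ G ] (A G × q < f G))

β≡ : Class → ℚ → Set
β≡ A s = IsSup A density s

-- Since e/n ≤ e/(n − 1), bounds on ρ₁ over A bound the
-- density.  Conversely, gluing t copies of G ∈ A along one vertex stays in A (the 1-sum is a
-- minor of the disjoint union joined by a bridge) and has density te/(1 + t(n − 1)), which
-- exceeds any q < ρ₁(G) for large t; this gives (a).
-- A graph with at least three vertices is 2-connected, disconnected, or has a cut vertex; in the
-- last two cases it splits into two smaller induced subgraphs sharing at most one vertex whose
-- edge counts add up, so by induction on n a bound e·b ≤ a·(n − 1) with b ≤ a passes from the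
-- 2-connected members of A to all of A.  Without K₃ there are no 2-connected members (they
-- contain a cycle, hence a K₃ minor): then e ≤ n − 1, with equality for connected members, and
-- every forest is assembled inside A from single vertices by disjoint unions and one-vertex gluings.

module Submission where

open import Defs

open import Data.Bool as Bool using (Bool; true; false; if_then_else_; not; _∧_; _∨_; T)
open import Data.Bool.Properties using (T-≡; ∧-identityʳ; ∧-zeroʳ; ∧-conicalˡ; ∧-conicalʳ; ∨-zeroʳ; ∨-identityʳ)
open import Data.Empty using (⊥; ⊥-elim)
open import Data.Fin using (Fin; zero; suc; toℕ; fromℕ<; inject≤; inject₁; fromℕ; splitAt; _↑ˡ_; _↑ʳ_; join; punchIn; punchOut)
open import Data.Fin.Properties using (_≟_; suc-injective; inject≤-injective; toℕ-injective; toℕ-inject₁; toℕ-fromℕ; toℕ<n; any?; all?; ¬∀⟶∃¬; splitAt-↑ˡ; splitAt-↑ʳ; join-splitAt; splitAt⁻¹-↑ˡ; splitAt⁻¹-↑ʳ; ↑ˡ-injective; ↑ʳ-injective; punchIn-injective; punchInᵢ≢i; punchIn-punchOut; punchOut-punchIn; punchOut-cong; punchOut-injective; injective⇒≤)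
open import Data.Integer as ℤ using (ℤ; -[1+_]; +≤+; +<+; -<+)
import Data.Integer.Properties as ℤP
open import Data.List using (List; []; _∷_; length; map; allFin; tabulate)
open import Data.List.Membership.Propositional using (_∈_; _∉_)
open import Data.List.Properties using (map-cong)
open import Data.List.Relation.Unary.Any as Any using (here; there)
open import Data.Nat hiding (_≟_)
open import Data.Nat.Induction using (<-rec)
import Data.Nat.ListAction as List
open import Data.Nat.Properties as ℕP hiding (_≟_; suc-injective)
open import Data.Product using (Σ; ∃; ∃-syntax; _×_; _,_; proj₁; proj₂)
open import Data.Rational as ℚ using (ℚ; mkℚ; 0ℚ; 1ℚ; toℚᵘ; ↥_; ↧ₙ_) renaming (_/_ to _÷_)
import Data.Rational.Properties as ℚP
open import Data.Rational.Properties using (toℚᵘ-cancel-≤; toℚᵘ-mono-≤; toℚᵘ-cancel-<; toℚᵘ-mono-<; toℚᵘ-fromℚᵘ; fromℚᵘ-cong)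
open import Data.Rational.Unnormalised as U using (mkℚᵘ; *≤*; *<*; *≡*)
import Data.Rational.Unnormalised.Properties as UP
open import Data.Sum using (_⊎_; inj₁; inj₂)
open import Data.Unit using (tt)
open import Function using (_∘_)
open import Function.Bundles using (Equivalence)
open import Function.Definitions using (Injective)
open import Relation.Binary.Definitions using (tri<; tri≈; tri>)
open import Relation.Binary.PropositionalEquality
open import Relation.Nullary using (¬_; yes; no; Dec; does)
open import Relation.Nullary.Decidable using (⌊_⌋; dec-true; dec-false; map′; _×-dec_)
open import Algebra.Properties.CommutativeSemigroup ℕP.+-commutativeSemigroup using () renaming (interchange to +-interchange)
open import Algebra.Properties.CommutativeSemigroup ℕP.*-commutativeSemigroup using () renaming (x∙yz≈y∙xz to *-x∙yz≈y∙xz)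
open import Algebra.Properties.Semiring.Sum ℕP.+-*-semiring using (sum; sum-syntax; sum-cong-≗; sum-replicate-zero; ∑-distrib-+; ∑-comm; *-distribˡ-sum)

sum-map-tabulate : ∀ {n} {A : Set} (g : Fin n → A) (f : A → ℕ) → List.sum (map f (tabulate g)) ≡ ∑[ i < n ] f (g i)
sum-map-tabulate {zero} g f = refl
sum-map-tabulate {suc n} g f = cong (f (g zero) +_) (sum-map-tabulate (λ i → g (suc i)) f)

sum-map-allFin : ∀ {n} (f : Fin n → ℕ) → List.sum (map f (allFin n)) ≡ sum f
sum-map-allFin = sum-map-tabulate (λ i → i)

∑-mono-≤ : ∀ {n} {f g : Fin n → ℕ} → (∀ i → f i ≤ g i) → sum f ≤ sum g
∑-mono-≤ {zero} p = z≤n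
∑-mono-≤ {suc n} p = +-mono-≤ (p zero) (∑-mono-≤ (λ i → p (suc i)))

∑-zero : ∀ {n} {f : Fin n → ℕ} → (∀ i → f i ≡ 0) → sum f ≡ 0
∑-zero {n} p = trans (sum-cong-≗ p) (sum-replicate-zero n)

term≤∑ : ∀ {n} (f : Fin n → ℕ) i → f i ≤ sum f
term≤∑ f zero = m≤m+n _ _
term≤∑ f (suc i) = ≤-trans (term≤∑ (λ j → f (suc j)) i) (m≤n+m _ _)

∑≤* : ∀ {n} {f : Fin n → ℕ} c → (∀ i → f i ≤ c) → sum f ≤ n * c
∑≤* {zero} c p = z≤n
∑≤* {suc n} c p = +-mono-≤ (p zero) (∑≤* c (λ i → p (suc i)))

true≢false : ¬ true ≡ false
true≢false ()

-- ⌊_⌋ rather than does, so that this agrees definitionally with the adjacency of K and addEdge.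
_==_ : ∀ {n} → Fin n → Fin n → Bool
i == j = ⌊ i ≟ j ⌋

==-refl : ∀ {n} (i : Fin n) → (i == i) ≡ true
==-refl i with i ≟ i
... | yes _ = refl
... | no i≢i = ⊥-elim (i≢i refl)

==-false : ∀ {n} {i j : Fin n} → ¬ i ≡ j → (i == j) ≡ false
==-false {i = i} {j} i≢j with i ≟ j
... | yes i≡j = ⊥-elim (i≢j i≡j)
... | no _ = refl

==-true : ∀ {n} {i j : Fin n} → (i == j) ≡ true → i ≡ j
==-true {i = i} {j} p with i ≟ j
... | yes q = q

==-false⁻¹ : ∀ {n} {i j : Fin n} → (i == j) ≡ false → ¬ i ≡ j
==-false⁻¹ {i = i} p refl = true≢false (trans (sym (==-refl i)) p)

==-sym : ∀ {n} (i j : Fin n) → (i == j) ≡ (j == i)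
==-sym i j with i ≟ j
... | yes refl = sym (==-refl i)
... | no i≢j = sym (==-false (λ j≡i → i≢j (sym j≡i)))

==-respects-⇔ : ∀ {n m} {a b : Fin n} {c d : Fin m} → (a ≡ b → c ≡ d) → (c ≡ d → a ≡ b) → (a == b) ≡ (c == d)
==-respects-⇔ {a = a} {b} {c} {d} f g with a ≟ b
... | yes a≡b = sym (trans (cong (c ==_) (sym (f a≡b))) (==-refl c))
... | no a≢b = sym (==-false (λ c≡d → a≢b (g c≡d)))

==-suc : ∀ {n} (i j : Fin n) → (suc i == suc j) ≡ (i == j)
==-suc i j = ==-respects-⇔ suc-injective (cong suc)

when : Bool → ℕ → ℕ
when b x = if b then x else 0

𝟙 : Bool → ℕ
𝟙 b = when b 1

when-* : ∀ b x → when b x ≡ 𝟙 b * x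
when-* true x = sym (+-identityʳ x)
when-* false x = refl

∑-when : ∀ {n} b (f : Fin n → ℕ) → ∑[ i < n ] when b (f i) ≡ when b (sum f)
∑-when true f = refl
∑-when {n} false f = sum-replicate-zero n

∑-δ : ∀ {n} (a : Fin n) (h : Fin n → ℕ) → ∑[ u < n ] when (u == a) (h u) ≡ h a
∑-δ zero h = trans (cong (h zero +_) (∑-zero {f = λ i → when (suc i == zero) (h (suc i))} (λ _ → refl))) (+-identityʳ (h zero))
∑-δ (suc a) h = trans (sum-cong-≗ (λ i → cong (λ b → when b (h (suc i))) (==-suc i a))) (∑-δ a (λ i → h (suc i)))

∑-δ′ : ∀ {n} (a : Fin n) (h : Fin n → ℕ) → ∑[ u < n ] when (a == u) (h u) ≡ h a
∑-δ′ a h = trans (sum-cong-≗ (λ u → cong (λ b → when b (h u)) (==-sym a u))) (∑-δ a h)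

module ImageSum {m n : ℕ} (g : Fin m → Fin n) (g-injective : Injective _≡_ _≡_ g)
                (p : Fin n → Bool) (p⇒image : ∀ u → p u ≡ true → ∃[ i ] g i ≡ u)
                (image⇒p : ∀ i → p (g i) ≡ true) where

  preimage-size : ∀ u → ∑[ i < m ] 𝟙 (g i == u) ≡ 𝟙 (p u)
  preimage-size u with p u in pu
  ... | true with p⇒image u pu
  ... | i₀ , gi₀≡u = trans (sum-cong-≗ (λ i → cong 𝟙 (gi==u i))) (∑-δ i₀ (λ _ → 1))
    where
    gi==u : ∀ i → (g i == u) ≡ (i == i₀)
    gi==u i with i ≟ i₀
    ... | yes refl = trans (cong (g i ==_) (sym gi₀≡u)) (==-refl _)
    ... | no i≢i₀ = ==-false (λ gi≡u → i≢i₀ (g-injective (trans gi≡u (sym gi₀≡u))))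
  preimage-size u | false = ∑-zero (λ i → cong 𝟙 (==-false (λ gi≡u → true≢false (trans (sym (image⇒p i)) (trans (cong p gi≡u) pu)))))

  ∑-image : ∀ (h : Fin n → ℕ) → ∑[ i < m ] h (g i) ≡ ∑[ u < n ] when (p u) (h u)
  ∑-image h = sym (begin
      ∑[ u < n ] when (p u) (h u)
    ≡⟨ sum-cong-≗ (λ u → trans (when-* (p u) (h u)) (trans (cong (_* h u) (sym (preimage-size u))) (*-comm _ (h u)))) ⟩
      ∑[ u < n ] (h u * ∑[ i < m ] 𝟙 (g i == u))
    ≡⟨ sum-cong-≗ (λ u → *-distribˡ-sum (h u) (λ i → 𝟙 (g i == u))) ⟩
      ∑[ u < n ] ∑[ i < m ] (h u * 𝟙 (g i == u))
    ≡⟨ sum-cong-≗ (λ u → sum-cong-≗ (λ i → trans (*-comm (h u) _) (sym (when-* (g i == u) (h u))))) ⟩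
      ∑[ u < n ] ∑[ i < m ] when (g i == u) (h u)
    ≡⟨ ∑-comm (λ u i → when (g i == u) (h u)) ⟩
      ∑[ i < m ] ∑[ u < n ] when (g i == u) (h u)
    ≡⟨ sum-cong-≗ (λ i → ∑-δ′ (g i) h) ⟩
      ∑[ i < m ] h (g i)
    ∎)
    where open ≡-Reasoning

adj⇒≢ : ∀ G {x y} → adj G x y ≡ true → ¬ x ≡ y
adj⇒≢ G {x} a refl = true≢false (trans (sym a) (adj-irrefl G x))

degreeSum : Graph → ℕ
degreeSum G = ∑[ i < n G ] ∑[ j < n G ] 𝟙 (adj G i j)

e≡∑ : ∀ G → e G ≡ ∑[ i < n G ] ∑[ j < n G ] 𝟙 (adj G i j ∧ (toℕ i <ᵇ toℕ j))
e≡∑ G = trans (cong List.sum (map-cong (λ i → sum-map-allFin (forward i)) (allFin (n G)))) (sum-map-allFin (λ i → sum (forward i)))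
  where
  forward : Fin (n G) → Fin (n G) → ℕ
  forward i j = 𝟙 (adj G i j ∧ (toℕ i <ᵇ toℕ j))

<ᵇ-true : ∀ {m n} → m < n → (m <ᵇ n) ≡ true
<ᵇ-true m<n with <⇒<ᵇ m<n
... | mᵇn rewrite Equivalence.to T-≡ mᵇn = refl

<ᵇ-false : ∀ {m n} → ¬ m < n → (m <ᵇ n) ≡ false
<ᵇ-false {m} {n} m≮n with m <ᵇ n in m<ᵇn
... | false = refl
... | true = ⊥-elim (m≮n (<ᵇ⇒< m n (Equivalence.from T-≡ m<ᵇn)))

𝟙-adj-by-order : ∀ G (i j : Fin (n G)) →
  𝟙 (adj G i j) ≡ 𝟙 (adj G i j ∧ (toℕ i <ᵇ toℕ j)) + 𝟙 (adj G j i ∧ (toℕ j <ᵇ toℕ i))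
𝟙-adj-by-order G i j with <-cmp (toℕ i) (toℕ j)
... | tri< i<j _ j≮i rewrite <ᵇ-true i<j | <ᵇ-false j≮i | ∧-identityʳ (adj G i j) | ∧-zeroʳ (adj G j i) = sym (+-identityʳ _)
... | tri> i≮j _ j<i rewrite <ᵇ-true j<i | <ᵇ-false i≮j | ∧-identityʳ (adj G j i) | ∧-zeroʳ (adj G i j) = cong 𝟙 (adj-sym G i j)
... | tri≈ _ i≡j _ rewrite toℕ-injective i≡j | adj-irrefl G j = refl

handshake : ∀ G → degreeSum G ≡ e G + e G
handshake G = begin
    degreeSum G
  ≡⟨ sum-cong-≗ (λ i → trans (sum-cong-≗ (𝟙-adj-by-order G i)) (∑-distrib-+ (forward i) (λ j → forward j i))) ⟩
    ∑[ i < n G ] (∑[ j < n G ] forward i j + ∑[ j < n G ] forward j i)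
  ≡⟨ ∑-distrib-+ (λ i → ∑[ j < n G ] forward i j) (λ i → ∑[ j < n G ] forward j i) ⟩
    ∑[ i < n G ] ∑[ j < n G ] forward i j + ∑[ i < n G ] ∑[ j < n G ] forward j i
  ≡⟨ cong₂ _+_ (sym (e≡∑ G)) (trans (∑-comm (λ i j → forward j i)) (sym (e≡∑ G))) ⟩
    e G + e G
  ∎
  where
  open ≡-Reasoning
  forward : Fin (n G) → Fin (n G) → ℕ
  forward i j = 𝟙 (adj G i j ∧ (toℕ i <ᵇ toℕ j))

m+m≡n+n⇒m≡n : ∀ {m n} → m + m ≡ n + n → m ≡ n
m+m≡n+n⇒m≡n {m} {n} p = *-cancelˡ-≡ m n 2 (trans (cong (m +_) (+-identityʳ m)) (trans p (sym (cong (n +_) (+-identityʳ n)))))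

degreeSumOn : (G : Graph) → (Fin (n G) → Bool) → ℕ
degreeSumOn G p = ∑[ u < n G ] when (p u) (∑[ v < n G ] when (p v) (𝟙 (adj G u v)))

degreeSum-embedding : ∀ (H G : Graph) (g : Fin (n H) → Fin (n G)) → Injective _≡_ _≡_ g →
  (p : Fin (n G) → Bool) → (∀ u → p u ≡ true → ∃[ i ] g i ≡ u) → (∀ i → p (g i) ≡ true) →
  (∀ i j → adj H i j ≡ adj G (g i) (g j)) → degreeSum H ≡ degreeSumOn G p
degreeSum-embedding H G g g-injective p p⇒image image⇒p adj-g = begin
    degreeSum H
  ≡⟨ sum-cong-≗ (λ i → sum-cong-≗ (λ j → cong 𝟙 (adj-g i j))) ⟩
    ∑[ i < n H ] ∑[ j < n H ] 𝟙 (adj G (g i) (g j))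
  ≡⟨ sum-cong-≗ (λ i → ∑-image (λ v → 𝟙 (adj G (g i) v))) ⟩
    ∑[ i < n H ] ∑[ v < n G ] when (p v) (𝟙 (adj G (g i) v))
  ≡⟨ ∑-image (λ u → ∑[ v < n G ] when (p v) (𝟙 (adj G u v))) ⟩
    degreeSumOn G p
  ∎
  where
  open ≡-Reasoning
  open ImageSum g g-injective p p⇒image image⇒p

when-when : ∀ a b x → when a (when b x) ≡ when (a ∧ b) x
when-when true b x = refl
when-when false b x = refl

EdgesSplit : (G : Graph) → (s t : Fin (n G) → Bool) → Set
EdgesSplit G s t = ∀ u v → adj G u v ≡ true → 𝟙 (s u ∧ s v) + 𝟙 (t u ∧ t v) ≡ 1

degreeSum-split : ∀ G (s t : Fin (n G) → Bool) → EdgesSplit G s t →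
  degreeSumOn G s + degreeSumOn G t ≡ degreeSum G
degreeSum-split G s t split = begin
    degreeSumOn G s + degreeSumOn G t
  ≡⟨ sym (∑-distrib-+ (side s) (side t)) ⟩
    ∑[ u < n G ] (when (s u) (∑[ v < n G ] when (s v) (x u v)) + when (t u) (∑[ v < n G ] when (t v) (x u v)))
  ≡⟨ sum-cong-≗ (λ u → cong₂ _+_ (sym (∑-when (s u) (λ v → when (s v) (x u v)))) (sym (∑-when (t u) (λ v → when (t v) (x u v))))) ⟩
    ∑[ u < n G ] (∑[ v < n G ] when (s u) (when (s v) (x u v)) + ∑[ v < n G ] when (t u) (when (t v) (x u v)))
  ≡⟨ sum-cong-≗ (λ u → trans (sym (∑-distrib-+ (λ v → when (s u) (when (s v) (x u v))) (λ v → when (t u) (when (t v) (x u v))))) (sum-cong-≗ (counted-once u))) ⟩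
    degreeSum G
  ∎
  where
  open ≡-Reasoning
  x : Fin (n G) → Fin (n G) → ℕ
  x u v = 𝟙 (adj G u v)
  side : (Fin (n G) → Bool) → Fin (n G) → ℕ
  side p u = when (p u) (∑[ v < n G ] when (p v) (x u v))
  one-side : ∀ u v → (𝟙 (s u ∧ s v) + 𝟙 (t u ∧ t v)) * x u v ≡ x u v
  one-side u v with adj G u v in uv
  ... | false = *-zeroʳ (𝟙 (s u ∧ s v) + 𝟙 (t u ∧ t v))
  ... | true = trans (*-identityʳ _) (split u v uv)
  counted-once : ∀ u v → when (s u) (when (s v) (x u v)) + when (t u) (when (t v) (x u v)) ≡ x u v
  counted-once u v = begin
      when (s u) (when (s v) (x u v)) + when (t u) (when (t v) (x u v))
    ≡⟨ cong₂ _+_ (trans (when-when (s u) (s v) (x u v)) (when-* (s u ∧ s v) (x u v)))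
                 (trans (when-when (t u) (t v) (x u v)) (when-* (t u ∧ t v) (x u v))) ⟩
      𝟙 (s u ∧ s v) * x u v + 𝟙 (t u ∧ t v) * x u v
    ≡⟨ sym (*-distribʳ-+ (x u v) (𝟙 (s u ∧ s v)) (𝟙 (t u ∧ t v))) ⟩
      (𝟙 (s u ∧ s v) + 𝟙 (t u ∧ t v)) * x u v
    ≡⟨ one-side u v ⟩
      x u v
    ∎

count : ∀ n → (Fin n → Bool) → ℕ
count n s = ∑[ u < n ] 𝟙 (s u)

enum : ∀ n (s : Fin n → Bool) → Fin (count n s) → Fin n
enum (suc n) s k with s zero
enum (suc n) s zero | true = zero
enum (suc n) s (suc k) | true = suc (enum n (λ u → s (suc u)) k)
enum (suc n) s k | false = suc (enum n (λ u → s (suc u)) k)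

enum-∈ : ∀ n (s : Fin n → Bool) k → s (enum n s k) ≡ true
enum-∈ (suc n) s k with s zero in s0
enum-∈ (suc n) s zero | true = s0
enum-∈ (suc n) s (suc k) | true = enum-∈ n (λ u → s (suc u)) k
enum-∈ (suc n) s k | false = enum-∈ n (λ u → s (suc u)) k

enum-injective : ∀ n (s : Fin n → Bool) → Injective _≡_ _≡_ (enum n s)
enum-injective (suc n) s {k} {l} p with s zero
enum-injective (suc n) s {zero} {zero} p | true = refl
enum-injective (suc n) s {suc k} {suc l} p | true = cong suc (enum-injective n (λ u → s (suc u)) (suc-injective p))
enum-injective (suc n) s {k} {l} p | false = enum-injective n (λ u → s (suc u)) (suc-injective p)

enum-surjective : ∀ n (s : Fin n → Bool) u → s u ≡ true → ∃[ k ] enum n s k ≡ u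
enum-surjective (suc n) s u p with s zero in s0
enum-surjective (suc n) s zero p | true = zero , refl
enum-surjective (suc n) s (suc u) p | true with enum-surjective n (λ u → s (suc u)) u p
... | k , q = suc k , cong suc q
enum-surjective (suc n) s zero p | false = ⊥-elim (true≢false (trans (sym p) s0))
enum-surjective (suc n) s (suc u) p | false with enum-surjective n (λ u → s (suc u)) u p
... | k , q = k , cong suc q

inducedOn : (G : Graph) → (Fin (n G) → Bool) → Graph
inducedOn G s = induced G (enum (n G) s)

degreeSum-inducedOn : ∀ G s → degreeSum (inducedOn G s) ≡ degreeSumOn G s
degreeSum-inducedOn G s =
  degreeSum-embedding (inducedOn G s) G (enum (n G) s) (enum-injective (n G) s) s (enum-surjective (n G) s) (enum-∈ (n G) s) (λ i j → refl)

e-split : ∀ G (s t : Fin (n G) → Bool) → EdgesSplit G s t → e (inducedOn G s) + e (inducedOn G t) ≡ e G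
e-split G s t split = m+m≡n+n⇒m≡n (begin
    (e Gs + e Gt) + (e Gs + e Gt)
  ≡⟨ +-interchange (e Gs) (e Gt) (e Gs) (e Gt) ⟩
    (e Gs + e Gs) + (e Gt + e Gt)
  ≡⟨ sym (cong₂ _+_ (handshake Gs) (handshake Gt)) ⟩
    degreeSum Gs + degreeSum Gt
  ≡⟨ cong₂ _+_ (degreeSum-inducedOn G s) (degreeSum-inducedOn G t) ⟩
    degreeSumOn G s + degreeSumOn G t
  ≡⟨ degreeSum-split G s t split ⟩
    degreeSum G
  ≡⟨ handshake G ⟩
    e G + e G
  ∎)
  where
  open ≡-Reasoning
  Gs = inducedOn G s
  Gt = inducedOn G t

count-all : ∀ n (s : Fin n → Bool) → (∀ u → s u ≡ true) → count n s ≡ n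
count-all zero s all = refl
count-all (suc n) s all rewrite all zero = cong suc (count-all n _ (λ u → all (suc u)))

count≤n : ∀ n (s : Fin n → Bool) → count n s ≤ n
count≤n n s = ≤-trans (∑≤* 1 (λ u → 𝟙≤1 (s u))) (≤-reflexive (*-identityʳ n))
  where
  𝟙≤1 : ∀ b → 𝟙 b ≤ 1
  𝟙≤1 true = ≤-refl
  𝟙≤1 false = z≤n

count-== : ∀ n (x : Fin n) → count n (_== x) ≡ 1
count-== n x = ∑-δ x (λ _ → 1)

count-not : ∀ n (s : Fin n → Bool) → count n s + count n (not ∘ s) ≡ n
count-not n s = trans (sym (∑-distrib-+ (λ u → 𝟙 (s u)) (λ u → 𝟙 (not (s u))))) (trans (sum-cong-≗ (λ u → 𝟙-not (s u))) (count-all n (λ _ → true) (λ _ → refl)))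
  where
  𝟙-not : ∀ b → 𝟙 b + 𝟙 (not b) ≡ 1
  𝟙-not true = refl
  𝟙-not false = refl

count-remove : ∀ n (s : Fin n → Bool) x → s x ≡ true → count n s ≡ suc (count n (λ u → s u ∧ not (u == x)))
count-remove n s x sx = trans (sum-cong-≗ split-off-x) (trans (∑-distrib-+ (λ u → 𝟙 (u == x)) (λ u → 𝟙 (s u ∧ not (u == x)))) (cong (_+ count n (λ u → s u ∧ not (u == x))) (count-== n x)))
  where
  split-off-x : ∀ u → 𝟙 (s u) ≡ 𝟙 (u == x) + 𝟙 (s u ∧ not (u == x))
  split-off-x u with u == x in u==x
  ... | true rewrite ==-true u==x | sx = refl
  ... | false rewrite ∧-identityʳ (s u) = refl

count-pos : ∀ n (s : Fin n → Bool) x → s x ≡ true → 1 ≤ count n s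
count-pos n s x sx rewrite count-remove n s x sx = s≤s z≤n

count<n : ∀ n (s : Fin n → Bool) x → s x ≡ false → count n s < n
count<n n s x sx = begin-strict
    count n s
  <⟨ m<m+n (count n s) (count-pos n (not ∘ s) x (cong not sx)) ⟩
    count n s + count n (not ∘ s)
  ≡⟨ count-not n s ⟩
    n
  ∎
  where open ≤-Reasoning

module _ {G : Graph} where
  reach-start : ∀ {P u x} → Reach G P u x → P u
  reach-start (here p) = p
  reach-start (step r _ _) = reach-start r

  reach-end : ∀ {P u x} → Reach G P u x → P x
  reach-end (here p) = p
  reach-end (step r _ p) = p

  reach-mono : ∀ {P Q : Fin (n G) → Set} → (∀ w → P w → Q w) → ∀ {u x} → Reach G P u x → Reach G Q u x
  reach-mono f (here p) = here (f _ p)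
  reach-mono f (step r a p) = step (reach-mono f r) a (f _ p)

  reach-trans : ∀ {P u w x} → Reach G P u w → Reach G P w x → Reach G P u x
  reach-trans r (here _) = r
  reach-trans r (step r' a p) = step (reach-trans r r') a p

  reach-edge : ∀ {P u w} → P u → P w → adj G u w ≡ true → Reach G P u w
  reach-edge pu pw a = step (here pu) a pw

  reach-cons : ∀ {P u w x} → P u → adj G u w ≡ true → Reach G P w x → Reach G P u x
  reach-cons pu a r = reach-trans (reach-edge pu (reach-start r) a) r

  reach-sym : ∀ {P u x} → Reach G P u x → Reach G P x u
  reach-sym (here p) = here p
  reach-sym (step r a p) = reach-cons p (trans (adj-sym G _ _) a) (reach-sym r)

  reach-first-step : ∀ {P u t} → Reach G P u t →
    t ≡ u ⊎ ∃[ w ] (adj G u w ≡ true × Reach G (λ z → P z × ¬ z ≡ u) w t)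
  reach-first-step (here _) = inj₁ refl
  reach-first-step {u = u} (step {w} {t} r a pt) with t ≟ u
  ... | yes t≡u = inj₁ t≡u
  ... | no t≢u with reach-first-step r
  ... | inj₁ refl = inj₂ (t , a , here (pt , t≢u))
  ... | inj₂ (w' , a' , r') = inj₂ (w' , a' , step r' a (pt , t≢u))

  reach-prefixes : ∀ {P u t} → Reach G P u t → Reach G (Reach G P u) u t
  reach-prefixes (here p) = here (here p)
  reach-prefixes (step r a p) = step (reach-prefixes r) a (step r a p)

  reach-until : ∀ {P : Fin (n G) → Set} {u t} x → ¬ u ≡ x → Reach G P u t →
    Reach G (λ z → P z × ¬ z ≡ x) u t ⊎ ∃[ w ] (Reach G (λ z → P z × ¬ z ≡ x) u w × adj G w x ≡ true)
  reach-until x u≢x (here p) = inj₁ (here (p , u≢x))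
  reach-until x u≢x (step {w} {t} r a p) with reach-until x u≢x r
  ... | inj₂ hit = inj₂ hit
  ... | inj₁ r' with t ≟ x
  ... | yes refl = inj₂ (w , r' , a)
  ... | no t≢x = inj₁ (step r' a (p , t≢x))

witness : ∀ {P : Set} (d : Dec P) → does d ≡ true → P
witness (yes p) _ = p

module Decide (G : Graph) where
  ReachIn : (Fin (n G) → Bool) → Fin (n G) → Fin (n G) → Set
  ReachIn s = Reach G (λ w → s w ≡ true)

  -- A walk from u inside s either stops at u or continues from a neighbour inside s ∖ {u}.
  reachIn?-within : ∀ fuel (s : Fin (n G) → Bool) → count (n G) s ≤ fuel → ∀ u x → Dec (ReachIn s u x)
  reachIn?-within fuel s c u x with s u in su
  ... | false = no (λ r → true≢false (trans (sym (reach-start r)) su))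
  ... | true with u ≟ x
  ... | yes refl = yes (here su)
  reachIn?-within zero s c u x | true | no _ = ⊥-elim (1+n≢0 (trans (sym (count-remove (n G) s u su)) (n≤0⇒n≡0 c)))
  reachIn?-within (suc fuel) s c u x | true | no u≢x
    with any? (λ w → (adj G u w Bool.≟ true) ×-dec reachIn?-within fuel s-u c-u w x)
    where
    s-u : Fin (n G) → Bool
    s-u w = s w ∧ not (w == u)
    c-u : count (n G) s-u ≤ fuel
    c-u = ≤-pred (≤-trans (≤-reflexive (sym (count-remove (n G) s u su))) c)
  ... | yes (w , a , r) = yes (reach-cons su a (reach-mono (λ z → ∧-conicalˡ (s z) _) r))
  ... | no no-step = no (λ r → via-first-step (reach-first-step r))
    where
    removed : ∀ z → s z ≡ true × ¬ z ≡ u → (s z ∧ not (z == u)) ≡ true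
    removed z (sz , z≢u) rewrite sz | ==-false z≢u = refl
    via-first-step : x ≡ u ⊎ ∃[ w ] (adj G u w ≡ true × Reach G (λ z → s z ≡ true × ¬ z ≡ u) w x) → ⊥
    via-first-step (inj₁ x≡u) = u≢x (sym x≡u)
    via-first-step (inj₂ (w , a , r)) = no-step (w , a , reach-mono removed r)

  reachIn? : ∀ (s : Fin (n G) → Bool) u x → Dec (ReachIn s u x)
  reachIn? s = reachIn?-within (n G) s (count≤n (n G) s)

  sameComponent? : ∀ u x → Dec (SameComponent G u x)
  sameComponent? u x = map′ (reach-mono (λ _ _ → tt)) (reach-mono (λ _ _ → refl)) (reachIn? (λ _ → true) u x)

  reachAvoiding? : ∀ z u x → Dec (Reach G (λ w → ¬ w ≡ z) u x)
  reachAvoiding? z u x = map′ (reach-mono (λ w → ==-false⁻¹ ∘ ≡-not)) (reach-mono (λ w w≢z → cong not (==-false w≢z)))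
                           (reachIn? (λ w → not (w == z)) u x)
    where
    ≡-not : ∀ {b} → not b ≡ true → b ≡ false
    ≡-not {false} _ = refl

embedding⇒minor : ∀ (H G : Graph) (g : Fin (n H) → Fin (n G)) → Injective _≡_ _≡_ g →
  (∀ i j → adj H i j ≡ true → adj G (g i) (g j) ≡ true) → H ≼ G
embedding⇒minor H G g g-injective adj-g = branch , nonempty , disjoint , connected , adjacent
  where
  branch : Fin (n H) → Fin (n G) → Bool
  branch h x = g h == x
  nonempty : ∀ h → ∃[ x ] branch h x ≡ true
  nonempty h = g h , ==-refl (g h)
  disjoint : ∀ h h' x → branch h x ≡ true → branch h' x ≡ true → h ≡ h'
  disjoint h h' x p q = g-injective (trans (==-true p) (sym (==-true q)))
  connected : ∀ h x y → branch h x ≡ true → branch h y ≡ true → Reach G (λ w → branch h w ≡ true) x y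
  connected h x y p q rewrite sym (==-true p) | sym (==-true q) = here (==-refl (g h))
  adjacent : ∀ h h' → adj H h h' ≡ true → ∃[ x ] ∃[ y ] (branch h x ≡ true × branch h' y ≡ true × adj G x y ≡ true)
  adjacent h h' a = g h , g h' , ==-refl _ , ==-refl _ , adj-g h h' a

inducedOn-minor : ∀ G s → inducedOn G s ≼ G
inducedOn-minor G s = embedding⇒minor (inducedOn G s) G (enum (n G) s) (enum-injective (n G) s) (λ i j a → a)

Disconnected : Graph → Set
Disconnected G = ∃[ y ] ∃[ z ] ¬ SameComponent G y z

AvoidsCut : (G : Graph) → Fin (n G) → Fin (n G) → Fin (n G) → Set
AvoidsCut G x y z = ¬ y ≡ x → ¬ z ≡ x → Reach G (λ w → ¬ w ≡ x) y z

CutVertex : (G : Graph) → Fin (n G) → Set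
CutVertex G x = ∃[ y ] ∃[ z ] (¬ y ≡ x × ¬ z ≡ x × ¬ Reach G (λ w → ¬ w ≡ x) y z)

avoidsCut? : ∀ G x y z → Dec (AvoidsCut G x y z)
avoidsCut? G x y z with y ≟ x | z ≟ x
... | yes y≡x | _ = yes (λ y≢x → ⊥-elim (y≢x y≡x))
... | no _ | yes z≡x = yes (λ _ z≢x → ⊥-elim (z≢x z≡x))
... | no y≢x | no z≢x = map′ (λ r _ _ → r) (λ avoid → avoid y≢x z≢x) (Decide.reachAvoiding? G x y z)

¬∀⟶∃¬₂ : ∀ {n} {P : Fin n → Fin n → Set} → (∀ y z → Dec (P y z)) → ¬ (∀ y z → P y z) → ∃[ y ] ∃[ z ] ¬ P y z
¬∀⟶∃¬₂ {n} P? ¬∀ with ¬∀⟶∃¬ n _ (λ y → all? (P? y)) ¬∀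
... | y , ¬∀z with ¬∀⟶∃¬ n _ (P? y) ¬∀z
... | z , ¬Pyz = y , z , ¬Pyz

twoConnected-or-separable : ∀ G → 3 ≤ n G → TwoConnected G ⊎ Disconnected G ⊎ (Connected G × ∃ (CutVertex G))
twoConnected-or-separable G 3≤n with all? (λ y → all? (Decide.sameComponent? G y))
... | no ¬con = inj₂ (inj₁ (¬∀⟶∃¬₂ (Decide.sameComponent? G) ¬con))
... | yes con with all? (λ x → all? (λ y → all? (avoidsCut? G x y)))
... | yes avoid = inj₁ (3≤n , con , avoid)
... | no ¬avoid with ¬∀⟶∃¬ (n G) _ (λ x → all? (λ y → all? (avoidsCut? G x y))) ¬avoid
... | x , ¬avoid-x with ¬∀⟶∃¬₂ (avoidsCut? G x) ¬avoid-x
... | y , z , ¬yz = inj₂ (inj₂ (con , x , y , z , (λ y≡x → ¬yz (λ y≢x → ⊥-elim (y≢x y≡x))) ,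
                                               (λ z≡x → ¬yz (λ _ z≢x → ⊥-elim (z≢x z≡x))) , (λ r → ¬yz (λ _ _ → r))))

record Separation (G : Graph) : Set where
  field
    left right : Fin (n G) → Bool
    edges-split : EdgesSplit G left right
    left-proper : ∃[ a ] left a ≡ false
    right-proper : ∃[ a ] right a ≡ false
    left-nonempty : ∃[ a ] left a ≡ true
    right-nonempty : ∃[ a ] right a ≡ true
    overlap≤1 : count (n G) left + count (n G) right ≤ suc (n G)

module ComponentSeparation (G : Graph) (y z : Fin (n G)) (y≁z : ¬ SameComponent G y z) where
  open Decide G

  reached : Fin (n G) → Bool
  reached u = does (sameComponent? y u)

  reached-closed : ∀ u v → adj G u v ≡ true → reached u ≡ true → reached v ≡ true
  reached-closed u v a p = dec-true (sameComponent? y v) (step (witness (sameComponent? y u) p) a tt)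

  reached-edge : ∀ u v → adj G u v ≡ true → reached u ≡ reached v
  reached-edge u v a with reached u in ru | reached v in rv
  ... | true | true = refl
  ... | false | false = refl
  ... | true | false = ⊥-elim (true≢false (trans (sym (reached-closed u v a ru)) rv))
  ... | false | true = ⊥-elim (true≢false (trans (sym (reached-closed v u (trans (adj-sym G v u) a) rv)) ru))

  separation : Separation G
  separation = record
    { left = reached
    ; right = not ∘ reached
    ; edges-split = split
    ; left-proper = z , dec-false (sameComponent? y z) y≁z
    ; right-proper = y , cong not (dec-true (sameComponent? y y) (here tt))
    ; left-nonempty = y , dec-true (sameComponent? y y) (here tt)
    ; right-nonempty = z , cong not (dec-false (sameComponent? y z) y≁z)
    ; overlap≤1 = ≤-trans (≤-reflexive (count-not (n G) reached)) (n≤1+n _) }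
    where
    split : EdgesSplit G reached (not ∘ reached)
    split u v a rewrite reached-edge u v a with reached v
    ... | true = refl
    ... | false = refl

module CutVertexSeparation (G : Graph) (x y z : Fin (n G)) (y≢x : ¬ y ≡ x) (z≢x : ¬ z ≡ x)
                           (y↛z : ¬ Reach G (λ w → ¬ w ≡ x) y z) where
  open Decide G

  reached : Fin (n G) → Bool
  reached u = does (reachAvoiding? x y u)

  reached-x : reached x ≡ false
  reached-x = dec-false (reachAvoiding? x y x) (λ r → reach-end r refl)

  reached-y : reached y ≡ true
  reached-y = dec-true (reachAvoiding? x y y) (here y≢x)

  reached-z : reached z ≡ false
  reached-z = dec-false (reachAvoiding? x y z) y↛z

  reached-closed : ∀ u v → adj G u v ≡ true → reached u ≡ true → ¬ v ≡ x → reached v ≡ true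
  reached-closed u v a p v≢x = dec-true (reachAvoiding? x y v) (step (witness (reachAvoiding? x y u) p) a v≢x)

  left right : Fin (n G) → Bool
  left u = reached u ∨ (u == x)
  right u = not (reached u)

  left-x : left x ≡ true
  left-x rewrite ==-refl x = ∨-zeroʳ (reached x)

  right-x : right x ≡ true
  right-x = cong not reached-x

  split : EdgesSplit G left right
  split u v a with reached u in ru | reached v in rv | u == x in u==x | v == x in v==x
  ... | true | true | _ | _ = refl
  ... | true | false | _ | true = refl
  ... | true | false | _ | false = ⊥-elim (true≢false (trans (sym (reached-closed u v a ru (==-false⁻¹ v==x))) rv))
  ... | false | true | true | _ = refl
  ... | false | true | false | _ = ⊥-elim (true≢false (trans (sym (reached-closed v u (trans (adj-sym G v u) a) rv (==-false⁻¹ u==x))) ru))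
  ... | false | false | false | _ = refl
  ... | false | false | true | false = refl
  ... | false | false | true | true rewrite ==-true u==x | ==-true v==x = ⊥-elim (true≢false (trans (sym a) (adj-irrefl G x)))

  count-left+right : count (n G) left + count (n G) right ≡ suc (n G)
  count-left+right = trans (sym (∑-distrib-+ (𝟙 ∘ left) (𝟙 ∘ right))) (trans (sum-cong-≗ x-twice) (trans (∑-distrib-+ (λ u → 𝟙 (u == x)) (λ _ → 1))
              (cong₂ _+_ (count-== (n G) x) (count-all (n G) (λ _ → true) (λ _ → refl)))))
    where
    x-twice : ∀ u → 𝟙 (left u) + 𝟙 (right u) ≡ 𝟙 (u == x) + 𝟙 true
    x-twice u with u == x in u==x
    ... | true rewrite ==-true u==x | reached-x = refl
    ... | false with reached u
    ... | true = refl
    ... | false = refl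

  separation : Separation G
  separation = record
    { left = left
    ; right = right
    ; edges-split = split
    ; left-proper = z , left-z
    ; right-proper = y , cong not reached-y
    ; left-nonempty = y , cong (_∨ (y == x)) reached-y
    ; right-nonempty = z , cong not reached-z
    ; overlap≤1 = ≤-reflexive count-left+right }
    where
    left-z : left z ≡ false
    left-z rewrite reached-z = ==-false z≢x

degree≤n∸1 : ∀ G i → ∑[ j < n G ] 𝟙 (adj G i j) ≤ n G ∸ 1
degree≤n∸1 G i = ≤-trans (∑-mono-≤ adj≤≢) (≤-reflexive count-others)
  where
  adj≤≢ : ∀ j → 𝟙 (adj G i j) ≤ 𝟙 (not (j == i))
  adj≤≢ j with j == i in j==i
  ... | true rewrite ==-true j==i | adj-irrefl G i = z≤n
  ... | false with adj G i j
  ... | true = ≤-refl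
  ... | false = z≤n
  count-others : count (n G) (not ∘ (_== i)) ≡ n G ∸ 1
  count-others = trans (sym (m+n∸m≡n 1 _))
    (cong (_∸ 1) (trans (cong (_+ count (n G) (not ∘ (_== i))) (sym (count-== (n G) i))) (count-not (n G) (_== i))))

e-small : ∀ G → n G ≤ 2 → e G ≤ n G ∸ 1
e-small G n≤2 = *-cancelˡ-≤ 2 (begin
    2 * e G
  ≡⟨ cong (e G +_) (+-identityʳ (e G)) ⟩
    e G + e G
  ≡⟨ sym (handshake G) ⟩
    degreeSum G
  ≤⟨ ∑≤* (n G ∸ 1) (degree≤n∸1 G) ⟩
    n G * (n G ∸ 1)
  ≤⟨ *-monoˡ-≤ (n G ∸ 1) n≤2 ⟩
    2 * (n G ∸ 1)
  ∎)
  where open ≤-Reasoning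

adj⇒1≤e : ∀ G u v → adj G u v ≡ true → 1 ≤ e G
adj⇒1≤e G u v a = 1≤m+m⇒1≤m (begin
    1
  ≡⟨ cong 𝟙 (sym a) ⟩
    𝟙 (adj G u v)
  ≤⟨ term≤∑ (λ j → 𝟙 (adj G u j)) v ⟩
    ∑[ j < n G ] 𝟙 (adj G u j)
  ≤⟨ term≤∑ (λ i → ∑[ j < n G ] 𝟙 (adj G i j)) u ⟩
    degreeSum G
  ≡⟨ handshake G ⟩
    e G + e G
  ∎)
  where
  open ≤-Reasoning
  1≤m+m⇒1≤m : ∀ {m} → 1 ≤ m + m → 1 ≤ m
  1≤m+m⇒1≤m {suc m} _ = s≤s z≤n

two-distinct : ∀ {k} → 2 ≤ k → Σ (Fin k) λ u → Σ (Fin k) λ v → ¬ u ≡ v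
two-distinct {suc (suc k)} _ = zero , suc zero , λ ()
two-distinct {suc zero} (s≤s ())

distinct-connected⇒1≤e : ∀ G u v → ¬ u ≡ v → SameComponent G u v → 1 ≤ e G
distinct-connected⇒1≤e G u v u≢v r with reach-first-step r
... | inj₁ v≡u = ⊥-elim (u≢v (sym v≡u))
... | inj₂ (w , a , _) = adj⇒1≤e G u w a

size-induction : (P : Graph → Set) → (∀ G → (∀ H → n H < n G → P H) → P G) → ∀ G → P G
size-induction P inductive-step G = <-rec (λ k → ∀ G → n G ≡ k → P G) (λ { k ih G refl → inductive-step G (λ H H<G → ih H<G H refl) }) (n G) G refl

∸1+∸1≤∸1 : ∀ {a b k} → 1 ≤ a → 1 ≤ b → a + b ≤ suc k → (a ∸ 1) + (b ∸ 1) ≤ k ∸ 1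
∸1+∸1≤∸1 {suc p} {suc q} {k} _ _ le = ∸-monoˡ-≤ 1 (subst (_≤ k) (+-suc p q) (≤-pred le))

∸1+∸1≡∸1 : ∀ {a b k} → 1 ≤ a → 1 ≤ b → a + b ≡ suc k → (a ∸ 1) + (b ∸ 1) ≡ k ∸ 1
∸1+∸1≡∸1 {suc p} {suc q} _ _ eq = cong (_∸ 1) (trans (sym (+-suc p q)) (ℕP.suc-injective eq))

module _ {G : Graph} (sp : Separation G) where
  open Separation sp

  left< : count (n G) left < n G
  left< = count<n (n G) left (proj₁ left-proper) (proj₂ left-proper)

  right< : count (n G) right < n G
  right< = count<n (n G) right (proj₁ right-proper) (proj₂ right-proper)

  left-pos : 1 ≤ count (n G) left
  left-pos = count-pos (n G) left (proj₁ left-nonempty) (proj₂ left-nonempty)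

  right-pos : 1 ≤ count (n G) right
  right-pos = count-pos (n G) right (proj₁ right-nonempty) (proj₂ right-nonempty)

  separation-e : e (inducedOn G left) + e (inducedOn G right) ≡ e G
  separation-e = e-split G left right edges-split

  separation-size : (count (n G) left ∸ 1) + (count (n G) right ∸ 1) ≤ n G ∸ 1
  separation-size = ∸1+∸1≤∸1 left-pos right-pos overlap≤1

module EdgeBound (A : Class) (minorClosed : MinorClosed A) (a b : ℕ) (b≤a : b ≤ a)
    (twoConnected-bound : ∀ H → A H → TwoConnected H → e H * b ≤ a * (n H ∸ 1)) where

  Bounded : Graph → Set
  Bounded G = A G → e G * b ≤ a * (n G ∸ 1)

  small-bound : ∀ G → n G ≤ 2 → Bounded G
  small-bound G n≤2 _ = begin
      e G * b
    ≤⟨ *-mono-≤ (e-small G n≤2) b≤a ⟩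
      (n G ∸ 1) * a
    ≡⟨ *-comm (n G ∸ 1) a ⟩
      a * (n G ∸ 1)
    ∎
    where open ≤-Reasoning

  separated-bound : ∀ G (sp : Separation G) → (∀ H → n H < n G → Bounded H) → Bounded G
  separated-bound G sp ih aG = begin
      e G * b
    ≡⟨ cong (_* b) (sym (separation-e sp)) ⟩
      (e Gl + e Gr) * b
    ≡⟨ *-distribʳ-+ b (e Gl) (e Gr) ⟩
      e Gl * b + e Gr * b
    ≤⟨ +-mono-≤ (ih Gl (left< sp) (minorClosed G Gl aG (inducedOn-minor G left)))
                (ih Gr (right< sp) (minorClosed G Gr aG (inducedOn-minor G right))) ⟩
      a * (n Gl ∸ 1) + a * (n Gr ∸ 1)
    ≡⟨ sym (*-distribˡ-+ a _ _) ⟩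
      a * ((n Gl ∸ 1) + (n Gr ∸ 1))
    ≤⟨ *-monoʳ-≤ a (separation-size sp) ⟩
      a * (n G ∸ 1)
    ∎
    where
    open ≤-Reasoning
    open Separation sp
    Gl = inducedOn G left
    Gr = inducedOn G right

  e-bound : ∀ G → Bounded G
  e-bound = size-induction Bounded inductive-step
    where
    inductive-step : ∀ G → (∀ H → n H < n G → Bounded H) → Bounded G
    inductive-step G ih with n G ≤? 2
    ... | yes n≤2 = small-bound G n≤2
    ... | no 2≮n with twoConnected-or-separable G (≰⇒> 2≮n)
    ... | inj₁ tc = λ aG → twoConnected-bound G aG tc
    ... | inj₂ (inj₁ (y , z , y≁z)) = separated-bound G (ComponentSeparation.separation G y z y≁z) ih
    ... | inj₂ (inj₂ (_ , x , y , z , y≢x , z≢x , y↛z)) =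
      separated-bound G (CutVertexSeparation.separation G x y z y≢x z≢x y↛z) ih

reach-lift : ∀ G (s : Fin (n G) → Bool) i {u} → Reach G (λ w → s w ≡ true) (enum (n G) s i) u →
  ∃[ k ] (enum (n G) s k ≡ u × SameComponent (inducedOn G s) i k)
reach-lift G s i (here _) = i , refl , here tt
reach-lift G s i (step {w} {u} r a p) with reach-lift G s i r | enum-surjective (n G) s u p
... | k' , enum-k'≡w , r' | k , enum-k≡u = k , enum-k≡u , step r' (trans (cong₂ (adj G) enum-k'≡w enum-k≡u) a) tt

inducedOn-connected : ∀ G (s : Fin (n G) → Bool) x → (∀ u → s u ≡ true → Reach G (λ w → s w ≡ true) u x) →
  Connected (inducedOn G s)
inducedOn-connected G s x to-x i j with reach-lift G s i (reach-trans (to-x _ (enum-∈ (n G) s i)) (reach-sym (to-x _ (enum-∈ (n G) s j))))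
... | k , enum-k≡enum-j , r rewrite enum-injective (n G) s enum-k≡enum-j = r

reach-before : ∀ {G : Graph} x {u} → ¬ u ≡ x → SameComponent G u x →
  ∃[ w ] (Reach G (λ z → ¬ z ≡ x) u w × adj G w x ≡ true)
reach-before x u≢x u~x with reach-until x u≢x u~x
... | inj₁ r = ⊥-elim (proj₂ (reach-end r) refl)
... | inj₂ (w , r , a) = w , reach-mono (λ _ → proj₂) r , a

module ConnectedCutVertexSeparation (G : Graph) (con : Connected G) (x y z : Fin (n G)) (y≢x : ¬ y ≡ x) (z≢x : ¬ z ≡ x)
   (y↛z : ¬ Reach G (λ w → ¬ w ≡ x) y z) where
  open CutVertexSeparation G x y z y≢x z≢x y↛z
  open Decide G

  reached⇒left : ∀ w → Reach G (λ z → ¬ z ≡ x) y w → left w ≡ true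
  reached⇒left w r = cong (_∨ (w == x)) (dec-true (reachAvoiding? x y w) r)

  y→x : Reach G (λ w → left w ≡ true) y x
  y→x with reach-before x y≢x (con y x)
  ... | w , r , a = step (reach-mono reached⇒left (reach-prefixes r)) a left-x

  left→x : ∀ u → left u ≡ true → Reach G (λ w → left w ≡ true) u x
  left→x u lu with u == x in u==x
  ... | true rewrite ==-true u==x = here left-x
  ... | false = reach-trans (reach-sym (reach-mono reached⇒left (reach-prefixes y→u))) y→x
    where
    y→u : Reach G (λ z → ¬ z ≡ x) y u
    y→u = witness (reachAvoiding? x y u) (trans (sym (∨-identityʳ (reached u))) lu)

  right→x : ∀ u → right u ≡ true → Reach G (λ w → right w ≡ true) u x
  right→x u ru with u ≟ x
  ... | yes refl = here ru
  ... | no u≢x with reach-before x u≢x (con u x)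
  ... | w , r , a = step (reach-mono unreached (reach-prefixes r)) a right-x
    where
    unreached : ∀ w' → Reach G (λ z → ¬ z ≡ x) u w' → right w' ≡ true
    unreached w' u→w' with reached w' in rw'
    ... | false = refl
    ... | true = ⊥-elim (true≢false (trans (sym ru)
                   (cong not (dec-true (reachAvoiding? x y u) (reach-trans (witness (reachAvoiding? x y w') rw') (reach-sym u→w'))))))

  left-connected : Connected (inducedOn G left)
  left-connected = inducedOn-connected G left x left→x

  right-connected : Connected (inducedOn G right)
  right-connected = inducedOn-connected G right x right→x

module TreeBound (A : Class) (minorClosed : MinorClosed A) (no-twoConnected : ∀ H → A H → ¬ TwoConnected H) where

  Spanned : Graph → Set
  Spanned G = A G → Connected G → n G ∸ 1 ≤ e G

  cut-vertex-bound : ∀ G (con : Connected G) x y z (y≢x : ¬ y ≡ x) (z≢x : ¬ z ≡ x) (y↛z : ¬ Reach G (λ w → ¬ w ≡ x) y z) →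
    (∀ H → n H < n G → Spanned H) → A G → n G ∸ 1 ≤ e G
  cut-vertex-bound G con x y z y≢x z≢x y↛z ih aG = begin
      n G ∸ 1
    ≡⟨ sym (∸1+∸1≡∸1 (left-pos separation) (right-pos separation) count-left+right) ⟩
      (n Gl ∸ 1) + (n Gr ∸ 1)
    ≤⟨ +-mono-≤ (ih Gl (left< separation) (minorClosed G Gl aG (inducedOn-minor G left)) left-connected)
                (ih Gr (right< separation) (minorClosed G Gr aG (inducedOn-minor G right)) right-connected) ⟩
      e Gl + e Gr
    ≡⟨ separation-e separation ⟩
      e G
    ∎
    where
    open ≤-Reasoning
    open CutVertexSeparation G x y z y≢x z≢x y↛z
    open ConnectedCutVertexSeparation G con x y z y≢x z≢x y↛z
    Gl = inducedOn G left
    Gr = inducedOn G right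

  n∸1≤e : ∀ G → Spanned G
  n∸1≤e = size-induction Spanned inductive-step
    where
    inductive-step : ∀ G → (∀ H → n H < n G → Spanned H) → Spanned G
    inductive-step G ih aG con with n G ≤? 1
    ... | yes n≤1 = ≤-trans (∸-monoˡ-≤ 1 n≤1) z≤n
    ... | no 1≮n with n G ≤? 2
    ... | yes n≤2 with two-distinct (≰⇒> 1≮n)
    ... | u , v , u≢v = ≤-trans (∸-monoˡ-≤ 1 n≤2) (distinct-connected⇒1≤e G u v u≢v (con u v))
    inductive-step G ih aG con | no 1≮n | no 2≮n with twoConnected-or-separable G (≰⇒> 2≮n)
    ... | inj₁ tc = ⊥-elim (no-twoConnected G aG tc)
    ... | inj₂ (inj₁ (y , z , y≁z)) = ⊥-elim (y≁z (con y z))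
    ... | inj₂ (inj₂ (_ , x , y , z , y≢x , z≢x , y↛z)) = cut-vertex-bound G con x y z y≢x z≢x y↛z ih aG

reach-along : ∀ {G : Graph} m (d : Fin (suc m) → Fin (n G)) (P : Fin (n G) → Set) → (∀ i → P (d i)) →
  (∀ (i : Fin m) → adj G (d (inject₁ i)) (d (suc i)) ≡ true) → ∀ j → Reach G P (d zero) (d j)
reach-along m d P pd ad zero = here (pd zero)
reach-along (suc m) d P pd ad (suc j) =
  reach-cons (pd zero) (ad zero) (reach-along m (λ i → d (suc i)) P (λ i → pd (suc i)) (λ i → ad (suc i)) j)

cycle⇒K3≼ : ∀ G → HasCycle G → K 3 ≼ G
cycle⇒K3≼ G (k , c , c-injective , c-adjacent , c-closes) = branch , nonempty , disjoint , connected , adjacent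
  where
  rest : Fin (suc k) → Fin (n G)
  rest j = c (suc (suc j))
  inRest : Fin (n G) → Bool
  inRest x = does (any? (λ j → x ≟ rest j))
  rest-inRest : ∀ j → inRest (rest j) ≡ true
  rest-inRest j = dec-true (any? (λ j' → rest j ≟ rest j')) (j , refl)
  rest≢ : ∀ {x i} → inRest x ≡ true → (x == c i) ≡ true → i ≡ zero ⊎ i ≡ suc zero → ⊥
  rest≢ {x} rx x==ci i01 with witness (any? (λ j → x ≟ rest j)) rx
  ... | j , x≡rest with c-injective (trans (sym (==-true x==ci)) x≡rest) | i01
  ... | refl | inj₁ ()
  ... | refl | inj₂ ()
  branch : Fin 3 → Fin (n G) → Bool
  branch zero x = x == c zero
  branch (suc zero) x = x == c (suc zero)
  branch (suc (suc zero)) x = inRest x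
  nonempty : ∀ h → ∃[ x ] branch h x ≡ true
  nonempty zero = c zero , ==-refl _
  nonempty (suc zero) = c (suc zero) , ==-refl _
  nonempty (suc (suc zero)) = rest zero , rest-inRest zero
  disjoint : ∀ h h' x → branch h x ≡ true → branch h' x ≡ true → h ≡ h'
  disjoint zero zero x p q = refl
  disjoint (suc zero) (suc zero) x p q = refl
  disjoint (suc (suc zero)) (suc (suc zero)) x p q = refl
  disjoint zero (suc zero) x p q with c-injective (trans (sym (==-true p)) (==-true q))
  ... | ()
  disjoint (suc zero) zero x p q with c-injective (trans (sym (==-true p)) (==-true q))
  ... | ()
  disjoint zero (suc (suc zero)) x p q = ⊥-elim (rest≢ q p (inj₁ refl))
  disjoint (suc (suc zero)) zero x p q = ⊥-elim (rest≢ p q (inj₁ refl))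
  disjoint (suc zero) (suc (suc zero)) x p q = ⊥-elim (rest≢ q p (inj₂ refl))
  disjoint (suc (suc zero)) (suc zero) x p q = ⊥-elim (rest≢ p q (inj₂ refl))
  rest-connected : ∀ j → Reach G (λ w → inRest w ≡ true) (rest zero) (rest j)
  rest-connected = reach-along k rest (λ w → inRest w ≡ true) rest-inRest (λ i → c-adjacent (suc (suc i)))
  connected : ∀ h x y → branch h x ≡ true → branch h y ≡ true → Reach G (λ w → branch h w ≡ true) x y
  connected zero x y p q rewrite ==-true p | ==-true q = here (==-refl _)
  connected (suc zero) x y p q rewrite ==-true p | ==-true q = here (==-refl _)
  connected (suc (suc zero)) x y p q with witness (any? (λ j → x ≟ rest j)) p | witness (any? (λ j → y ≟ rest j)) q
  ... | j , refl | j' , refl = reach-trans (reach-sym (rest-connected j)) (rest-connected j')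
  adjacent : ∀ h h' → adj (K 3) h h' ≡ true → ∃[ x ] ∃[ y ] (branch h x ≡ true × branch h' y ≡ true × adj G x y ≡ true)
  adjacent zero (suc zero) _ = c zero , c (suc zero) , ==-refl _ , ==-refl _ , c-adjacent zero
  adjacent (suc zero) zero _ = c (suc zero) , c zero , ==-refl _ , ==-refl _ , trans (adj-sym G _ _) (c-adjacent zero)
  adjacent (suc zero) (suc (suc zero)) _ = c (suc zero) , rest zero , ==-refl _ , rest-inRest zero , c-adjacent (suc zero)
  adjacent (suc (suc zero)) (suc zero) _ = rest zero , c (suc zero) , rest-inRest zero , ==-refl _ , trans (adj-sym G _ _) (c-adjacent (suc zero))
  adjacent zero (suc (suc zero)) _ = c zero , rest (fromℕ k) , ==-refl _ , rest-inRest (fromℕ k) , trans (adj-sym G _ _) c-closes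
  adjacent (suc (suc zero)) zero _ = rest (fromℕ k) , c zero , rest-inRest (fromℕ k) , ==-refl _ , c-closes
  adjacent zero zero ()
  adjacent (suc zero) (suc zero) ()
  adjacent (suc (suc zero)) (suc (suc zero)) ()

module _ (G : Graph) (P : Fin (n G) → Set) (u : Fin (n G)) where
  data SimplePath : Fin (n G) → List (Fin (n G)) → Set where
    start : P u → SimplePath u (u ∷ [])
    extend : ∀ {w t l} → SimplePath w l → adj G w t ≡ true → P t → t ∉ l → SimplePath t (t ∷ l)

module _ {G : Graph} {P : Fin (n G) → Set} {u : Fin (n G)} where
  simplePath-truncate : ∀ {w l t} → SimplePath G P u w l → t ∈ l → ∃[ l' ] SimplePath G P u t l'
  simplePath-truncate (start p) (here refl) = _ , start p
  simplePath-truncate (extend sp a pt t∉l) (here refl) = _ , extend sp a pt t∉l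
  simplePath-truncate (extend sp a pt t∉l) (there m) = simplePath-truncate sp m

  reach⇒simplePath : ∀ {t} → Reach G P u t → ∃[ l ] SimplePath G P u t l
  reach⇒simplePath (here p) = _ , start p
  reach⇒simplePath (step {w} {t} r a pt) with reach⇒simplePath r
  ... | l , sp with Any.any? (t ≟_) l
  ... | yes t∈l = simplePath-truncate sp t∈l
  ... | no t∉l = _ , extend sp a pt t∉l

nth : ∀ {A : Set} → List A → ℕ → A → A
nth [] j d = d
nth (x ∷ l) zero d = x
nth (x ∷ l) (suc j) d = nth l j d

nth-∈ : ∀ {A : Set} (l : List A) j d → j < length l → nth l j d ∈ l
nth-∈ (x ∷ l) zero d _ = here refl
nth-∈ (x ∷ l) (suc j) d (s≤s lt) = there (nth-∈ l j d lt)

module _ {G : Graph} {P : Fin (n G) → Set} {u : Fin (n G)} where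
  simplePath-head : ∀ {w l} → SimplePath G P u w l → ∀ d → nth l 0 d ≡ w
  simplePath-head (start _) d = refl
  simplePath-head (extend _ _ _ _) d = refl

  simplePath-last : ∀ {w l} → SimplePath G P u w l → ∀ d → nth l (length l ∸ 1) d ≡ u
  simplePath-last (start _) d = refl
  simplePath-last (extend (start _) _ _ _) d = refl
  simplePath-last (extend sp@(extend _ _ _ _) _ _ _) d = simplePath-last sp d

  simplePath-∈P : ∀ {w l} → SimplePath G P u w l → ∀ j d → j < length l → P (nth l j d)
  simplePath-∈P (start p) zero d _ = p
  simplePath-∈P (start p) (suc j) d (s≤s ())
  simplePath-∈P (extend _ _ pt _) zero d _ = pt
  simplePath-∈P (extend sp _ _ _) (suc j) d (s≤s lt) = simplePath-∈P sp j d lt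

  simplePath-adj : ∀ {w l} → SimplePath G P u w l → ∀ j d → suc j < length l → adj G (nth l j d) (nth l (suc j) d) ≡ true
  simplePath-adj (start _) zero d (s≤s ())
  simplePath-adj (extend sp a _ _) zero d _ = trans (adj-sym G _ _) (trans (cong (λ v → adj G v _) (simplePath-head sp d)) a)
  simplePath-adj (extend sp _ _ _) (suc j) d (s≤s lt) = simplePath-adj sp j d lt

  simplePath-injective : ∀ {w l} → SimplePath G P u w l → ∀ j j' d → j < length l → j' < length l → nth l j d ≡ nth l j' d → j ≡ j'
  simplePath-injective (start _) zero zero d _ _ _ = refl
  simplePath-injective (start _) (suc j) _ d (s≤s ()) _ _
  simplePath-injective (start _) zero (suc j) d _ (s≤s ()) _
  simplePath-injective (extend sp _ _ _) zero zero d _ _ _ = refl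
  simplePath-injective (extend {l = l} sp _ _ t∉l) zero (suc j') d _ (s≤s lt') q = ⊥-elim (t∉l (subst (_∈ l) (sym q) (nth-∈ l j' d lt')))
  simplePath-injective (extend {l = l} sp _ _ t∉l) (suc j) zero d (s≤s lt) _ q = ⊥-elim (t∉l (subst (_∈ l) q (nth-∈ l j d lt)))
  simplePath-injective (extend sp _ _ _) (suc j) (suc j') d (s≤s lt) (s≤s lt') q = cong suc (simplePath-injective sp j j' d lt lt' q)

third-vertex : ∀ {k} → 3 ≤ k → (a b : Fin k) → ∃[ c ] (¬ c ≡ a × ¬ c ≡ b)
third-vertex {suc (suc (suc k))} _ a b with zero ≟ a | zero ≟ b
... | no 0≢a | no 0≢b = zero , 0≢a , 0≢b
... | yes refl | _ with suc zero ≟ b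
... | no 1≢b = suc zero , (λ ()) , 1≢b
... | yes refl = suc (suc zero) , (λ ()) , (λ ())
third-vertex {suc (suc (suc k))} _ a b | no 0≢a | yes refl with suc zero ≟ a
... | no 1≢a = suc zero , 1≢a , (λ ())
... | yes refl = suc (suc zero) , (λ ()) , (λ ())
third-vertex {suc zero} (s≤s ()) _ _
third-vertex {suc (suc zero)} (s≤s (s≤s ())) _ _

module CycleThrough (G : Graph) (x u y : Fin (n G)) (x~y : adj G x y ≡ true) (u~x : adj G u x ≡ true)
  (u≢y : ¬ u ≡ y) {l : List (Fin (n G))} (sp : SimplePath G (λ w → ¬ w ≡ x) u y l) where

  L = length l

  2≤length : ∀ {l'} → SimplePath G (λ w → ¬ w ≡ x) u y l' → 2 ≤ length l'
  2≤length (start _) = ⊥-elim (u≢y refl)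
  2≤length (extend (start _) _ _ _) = s≤s (s≤s z≤n)
  2≤length (extend (extend _ _ _ _) _ _ _) = s≤s (s≤s z≤n)

  k = L ∸ 2

  k+2≡L : suc (suc k) ≡ L
  k+2≡L = trans (+-comm 2 k) (m∸n+n≡m (2≤length sp))

  vertex : ℕ → Fin (n G)
  vertex zero = x
  vertex (suc j) = nth l j x

  c : Fin (suc (suc (suc k))) → Fin (n G)
  c i = vertex (toℕ i)

  c-injective : Injective _≡_ _≡_ c
  c-injective {i} {j} q = toℕ-injective (vertex-injective (toℕ i) (toℕ j) (bound i) (bound j) q)
    where
    bound : ∀ (i : Fin (suc (suc (suc k)))) → toℕ i < suc L
    bound i = subst (λ m → toℕ i < suc m) k+2≡L (toℕ<n i)
    vertex-injective : ∀ a b → a < suc L → b < suc L → vertex a ≡ vertex b → a ≡ b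
    vertex-injective zero zero _ _ _ = refl
    vertex-injective zero (suc b) _ (s≤s b<L) q = ⊥-elim (simplePath-∈P sp b x b<L (sym q))
    vertex-injective (suc a) zero (s≤s a<L) _ q = ⊥-elim (simplePath-∈P sp a x a<L q)
    vertex-injective (suc a) (suc b) (s≤s a<L) (s≤s b<L) q = cong suc (simplePath-injective sp a b x a<L b<L q)

  c-adjacent : ∀ (i : Fin (suc (suc k))) → adj G (c (inject₁ i)) (c (suc i)) ≡ true
  c-adjacent i rewrite toℕ-inject₁ i = vertex-adjacent (toℕ i) (subst (λ m → toℕ i < m) k+2≡L (toℕ<n i))
    where
    vertex-adjacent : ∀ a → a < L → adj G (vertex a) (vertex (suc a)) ≡ true
    vertex-adjacent zero _ = trans (cong (adj G x) (simplePath-head sp x)) x~y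
    vertex-adjacent (suc a) a<L = simplePath-adj sp a x a<L

  c-closes : adj G (c (fromℕ (suc (suc k)))) (c zero) ≡ true
  c-closes = subst (λ m → adj G (vertex m) x ≡ true) (sym (toℕ-fromℕ (suc (suc k)))) (trans (cong (λ v → adj G v x) last≡u) u~x)
    where
    last≡u : nth l (suc k) x ≡ u
    last≡u = trans (cong (λ m → nth l m x) (cong (_∸ 1) k+2≡L)) (simplePath-last sp x)

  cycle : HasCycle G
  cycle = k , c , c-injective , c-adjacent , c-closes

twoConnected⇒cycle : ∀ G → TwoConnected G → HasCycle G
twoConnected⇒cycle G (3≤n , con , avoid) = cycle-at (fromℕ< (≤-trans (s≤s z≤n) 3≤n))
  where
  neighbour : ∀ x → ∃[ y ] adj G x y ≡ true
  neighbour x with third-vertex 3≤n x x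
  ... | w , w≢x , _ with reach-first-step (con x w)
  ... | inj₁ w≡x = ⊥-elim (w≢x w≡x)
  ... | inj₂ (y , x~y , _) = y , x~y
  cycle-at : Fin (n G) → HasCycle G
  cycle-at x with neighbour x
  ... | y , x~y with third-vertex 3≤n x y
  ... | w , w≢x , w≢y with reach-first-step (avoid y x w (adj⇒≢ G x~y) w≢y)
  ... | inj₁ w≡x = ⊥-elim (w≢x w≡x)
  ... | inj₂ (u , x~u , x→w) with reach-start x→w
  ... | u≢y , u≢x with reach⇒simplePath (avoid x u y u≢x (λ y≡x → adj⇒≢ G x~y (sym y≡x)))
  ... | l , sp = CycleThrough.cycle G x u y x~y (trans (adj-sym G u x) x~u) u≢y sp

splitAt-injective : ∀ m {k} {i j : Fin (m + k)} → splitAt m i ≡ splitAt m j → i ≡ j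
splitAt-injective m {k} {i} {j} p = trans (sym (join-splitAt m k i)) (trans (cong (join m k) p) (join-splitAt m k j))

module DisjointUnion (G1 G2 : Graph) where
  n1 = n G1
  n2 = n G2
  V = Fin (n1 + n2)

  adj⊎ : Fin n1 ⊎ Fin n2 → Fin n1 ⊎ Fin n2 → Bool
  adj⊎ (inj₁ a) (inj₁ b) = adj G1 a b
  adj⊎ (inj₂ a) (inj₂ b) = adj G2 a b
  adj⊎ (inj₁ _) (inj₂ _) = false
  adj⊎ (inj₂ _) (inj₁ _) = false

  adj⊎-sym : ∀ p q → adj⊎ p q ≡ adj⊎ q p
  adj⊎-sym (inj₁ a) (inj₁ b) = adj-sym G1 a b
  adj⊎-sym (inj₂ a) (inj₂ b) = adj-sym G2 a b
  adj⊎-sym (inj₁ _) (inj₂ _) = refl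
  adj⊎-sym (inj₂ _) (inj₁ _) = refl

  adj⊎-irrefl : ∀ p → adj⊎ p p ≡ false
  adj⊎-irrefl (inj₁ a) = adj-irrefl G1 a
  adj⊎-irrefl (inj₂ a) = adj-irrefl G2 a

  union : Graph
  union = record { n = n1 + n2 ; adj = λ i j → adj⊎ (splitAt n1 i) (splitAt n1 j)
             ; adj-sym = λ i j → adj⊎-sym (splitAt n1 i) (splitAt n1 j) ; adj-irrefl = λ i → adj⊎-irrefl (splitAt n1 i) }

  reach-stays-left : ∀ {P a b} → Reach union P a b → ∀ {a'} → splitAt n1 a ≡ inj₁ a' → ∃[ b' ] splitAt n1 b ≡ inj₁ b'
  reach-stays-left (here _) {a'} e = a' , e
  reach-stays-left (step {w} {t} r ad _) e with reach-stays-left r e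
  ... | w' , ew with splitAt n1 t in et
  ... | inj₁ t' = t' , refl
  ... | inj₂ t' rewrite ew with ad
  ... | ()

  reach-stays-right : ∀ {P a b} → Reach union P a b → ∀ {a'} → splitAt n1 a ≡ inj₂ a' → ∃[ b' ] splitAt n1 b ≡ inj₂ b'
  reach-stays-right (here _) {a'} e = a' , e
  reach-stays-right (step {w} {t} r ad _) e with reach-stays-right r e
  ... | w' , ew with splitAt n1 t in et
  ... | inj₂ t' = t' , refl
  ... | inj₁ t' rewrite ew with ad
  ... | ()

  module UnionInClass (A : Class) (minorClosed : MinorClosed A) (decomposable : Decomposable A) (G1∈A : A G1) (G2∈A : A G2) where
    component∈A : ∀ m (f : Fin m → V) → IsComponent union f → A (induced union f)
    component∈A zero f (() , _)
    component∈A (suc m) f (_ , f-injective , f-connected , _) with splitAt n1 (f zero) in f0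
    ... | inj₁ a0 = minorClosed G1 _ G1∈A (embedding⇒minor (induced union f) G1 g g-injective adj-g)
      where
      side : ∀ i → ∃[ b ] splitAt n1 (f i) ≡ inj₁ b
      side i = reach-stays-left (f-connected zero i) f0
      g : Fin (suc m) → Fin n1
      g i = proj₁ (side i)
      g-injective : Injective _≡_ _≡_ g
      g-injective {i} {j} p = f-injective (splitAt-injective n1 (trans (proj₂ (side i)) (trans (cong inj₁ p) (sym (proj₂ (side j))))))
      adj-g : ∀ i j → adj (induced union f) i j ≡ true → adj G1 (g i) (g j) ≡ true
      adj-g i j p rewrite proj₂ (side i) | proj₂ (side j) = p
    ... | inj₂ a0 = minorClosed G2 _ G2∈A (embedding⇒minor (induced union f) G2 g g-injective adj-g)
      where
      side : ∀ i → ∃[ b ] splitAt n1 (f i) ≡ inj₂ b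
      side i = reach-stays-right (f-connected zero i) f0
      g : Fin (suc m) → Fin n2
      g i = proj₁ (side i)
      g-injective : Injective _≡_ _≡_ g
      g-injective {i} {j} p = f-injective (splitAt-injective n1 (trans (proj₂ (side i)) (trans (cong inj₂ p) (sym (proj₂ (side j))))))
      adj-g : ∀ i j → adj (induced union f) i j ≡ true → adj G2 (g i) (g j) ≡ true
      adj-g i j p rewrite proj₂ (side i) | proj₂ (side j) = p

    union∈A : A union
    union∈A = proj₂ (decomposable union) component∈A

  module Bridged (x1 : Fin n1) (x2 : Fin n2) where
    x1ˡ : V
    x1ˡ = x1 ↑ˡ n2
    x2ʳ : V
    x2ʳ = n1 ↑ʳ x2

    x1ˡ≁x2ʳ : ¬ SameComponent union x1ˡ x2ʳ
    x1ˡ≁x2ʳ r with reach-stays-left r (splitAt-↑ˡ n1 x1 n2)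
    ... | b , e with trans (sym e) (splitAt-↑ʳ n1 n2 x2)
    ... | ()

    bridged : Graph
    bridged = addEdge union x1ˡ x2ʳ (diffComp⇒≢ union x1ˡ x2ʳ x1ˡ≁x2ʳ)

    bridged∈A : (A : Class) → BridgeAddable A → A union → A bridged
    bridged∈A A bridgeAddable union∈A′ = bridgeAddable union x1ˡ x2ʳ union∈A′ x1ˡ≁x2ʳ

    union⊆bridged : ∀ i j → adj union i j ≡ true → adj bridged i j ≡ true
    union⊆bridged i j p rewrite p = refl

    bridge-edge : adj bridged x1ˡ x2ʳ ≡ true
    bridge-edge with adj union x1ˡ x2ʳ
    ... | true = refl
    ... | false rewrite ==-refl x1ˡ | ==-refl x2ʳ = refl

    -- Contracting the bridge merges x1 and x2, so a graph assembled from parts of G1 and G2 meeting in one vertex is a minor.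
    module OneVertexGluing (H : Graph) (inL inR : Fin (n H) → Bool) (x : Fin (n H))
      (toL : Fin (n H) → Fin n1) (toR : Fin (n H) → Fin n2)
      (cover : ∀ v → (inL v ∨ inR v) ≡ true)
      (in-both : ∀ v → inL v ≡ true → inR v ≡ true → v ≡ x)
      (x-inL : inL x ≡ true) (x-inR : inR x ≡ true) (toL-x : toL x ≡ x1) (toR-x : toR x ≡ x2)
      (toL-injective : ∀ u v → inL u ≡ true → inL v ≡ true → toL u ≡ toL v → u ≡ v)
      (toR-injective : ∀ u v → inR u ≡ true → inR v ≡ true → toR u ≡ toR v → u ≡ v)
      (edges : ∀ u v → adj H u v ≡ true →
         (inL u ≡ true × inL v ≡ true × adj G1 (toL u) (toL v) ≡ true) ⊎ (inR u ≡ true × inR v ≡ true × adj G2 (toR u) (toR v) ≡ true))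
      where

      branch : Fin (n H) → V → Bool
      branch h w = (inL h ∧ (w == (toL h ↑ˡ n2))) ∨ (inR h ∧ (w == (n1 ↑ʳ toR h)))

      branch-cases : ∀ h w → branch h w ≡ true → (inL h ≡ true × w ≡ toL h ↑ˡ n2) ⊎ (inR h ≡ true × w ≡ n1 ↑ʳ toR h)
      branch-cases h w p with inL h in e1 | w == (toL h ↑ˡ n2) in e2
      ... | true | true = inj₁ (refl , ==-true e2)
      ... | true | false with inR h | w == (n1 ↑ʳ toR h) in e3
      ... | true | true = inj₂ (refl , ==-true e3)
      branch-cases h w p | false | _ with inR h | w == (n1 ↑ʳ toR h) in e3
      ... | true | true = inj₂ (refl , ==-true e3)

      branch-left : ∀ h → inL h ≡ true → branch h (toL h ↑ˡ n2) ≡ true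
      branch-left h p rewrite p | ==-refl (toL h ↑ˡ n2) = refl

      branch-right : ∀ h → inR h ≡ true → branch h (n1 ↑ʳ toR h) ≡ true
      branch-right h p rewrite p | ==-refl (n1 ↑ʳ toR h) with inL h ∧ ((n1 ↑ʳ toR h) == (toL h ↑ˡ n2))
      ... | true = refl
      ... | false = refl

      ↑ˡ≢↑ʳ : ∀ {a b} → a ↑ˡ n2 ≡ n1 ↑ʳ b → ⊥
      ↑ˡ≢↑ʳ {a} {b} e with trans (sym (splitAt-↑ˡ n1 a n2)) (trans (cong (splitAt n1) e) (splitAt-↑ʳ n1 n2 b))
      ... | ()

      nonempty : ∀ h → ∃[ w ] branch h w ≡ true
      nonempty h with inL h Bool.≟ true
      ... | yes e = toL h ↑ˡ n2 , branch-left h e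
      ... | no ne = n1 ↑ʳ toR h , branch-right h (orR (inL h) (inR h) ne (cover h))
        where
        orR : ∀ a b → ¬ a ≡ true → (a ∨ b) ≡ true → b ≡ true
        orR true b ne _ = ⊥-elim (ne refl)
        orR false b _ p = p

      disjoint : ∀ h h' w → branch h w ≡ true → branch h' w ≡ true → h ≡ h'
      disjoint h h' w p q with branch-cases h w p | branch-cases h' w q
      ... | inj₁ (a , e) | inj₁ (a' , e') = toL-injective h h' a a' (↑ˡ-injective n2 _ _ (trans (sym e) e'))
      ... | inj₂ (a , e) | inj₂ (a' , e') = toR-injective h h' a a' (↑ʳ-injective n1 _ _ (trans (sym e) e'))
      ... | inj₁ (a , e) | inj₂ (a' , e') = ⊥-elim (↑ˡ≢↑ʳ (trans (sym e) e'))
      ... | inj₂ (a , e) | inj₁ (a' , e') = ⊥-elim (↑ˡ≢↑ʳ (trans (sym e') e))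

      connected : ∀ h w w' → branch h w ≡ true → branch h w' ≡ true → Reach bridged (λ z → branch h z ≡ true) w w'
      connected h w w' p q with branch-cases h w p | branch-cases h w' q
      ... | inj₁ (a , refl) | inj₁ (a' , refl) = here p
      ... | inj₂ (a , refl) | inj₂ (a' , refl) = here p
      ... | inj₁ (a , refl) | inj₂ (a' , refl) with in-both h a a'
      ... | refl rewrite toL-x | toR-x = reach-edge p q bridge-edge
      connected h w w' p q | inj₂ (a , refl) | inj₁ (a' , refl) with in-both h a' a
      ... | refl rewrite toL-x | toR-x = reach-sym (reach-edge q p bridge-edge)

      adjacent : ∀ h h' → adj H h h' ≡ true → ∃[ w ] ∃[ w' ] (branch h w ≡ true × branch h' w' ≡ true × adj bridged w w' ≡ true)
      adjacent h h' a with edges h h' a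
      ... | inj₁ (p , q , e) = _ , _ , branch-left h p , branch-left h' q , union⊆bridged _ _ (adj-left e)
        where
        adj-left : adj G1 (toL h) (toL h') ≡ true → adj union (toL h ↑ˡ n2) (toL h' ↑ˡ n2) ≡ true
        adj-left e rewrite splitAt-↑ˡ n1 (toL h) n2 | splitAt-↑ˡ n1 (toL h') n2 = e
      ... | inj₂ (p , q , e) = _ , _ , branch-right h p , branch-right h' q , union⊆bridged _ _ (adj-right e)
        where
        adj-right : adj G2 (toR h) (toR h') ≡ true → adj union (n1 ↑ʳ toR h) (n1 ↑ʳ toR h') ≡ true
        adj-right e rewrite splitAt-↑ʳ n1 n2 (toR h) | splitAt-↑ʳ n1 n2 (toR h') = e

      gluing≼bridged : H ≼ bridged
      gluing≼bridged = branch , nonempty , disjoint , connected , adjacent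

enum⁻¹ : ∀ k (s : Fin k → Bool) → Fin (count k s) → Fin k → Fin (count k s)
enum⁻¹ k s d v with s v Bool.≟ true
... | yes p = proj₁ (enum-surjective k s v p)
... | no _ = d

enum-enum⁻¹ : ∀ k s d v → s v ≡ true → enum k s (enum⁻¹ k s d v) ≡ v
enum-enum⁻¹ k s d v p with s v Bool.≟ true
... | yes p' = proj₂ (enum-surjective k s v p')
... | no np = ⊥-elim (np p)

forest-induced : ∀ G {m} (f : Fin m → Fin (n G)) → Injective _≡_ _≡_ f → Forest G → Forest (induced G f)
forest-induced G f f-injective forest (k , c , c-injective , c-adjacent , c-closes) =
  forest (k , f ∘ c , c-injective ∘ f-injective , c-adjacent , c-closes)

injective-missing⇒< : ∀ {m k} (f : Fin m → Fin k) → Injective _≡_ _≡_ f → ∀ w → (∀ i → ¬ f i ≡ w) → m < k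
injective-missing⇒< {k = suc k} f f-injective w missed =
  s≤s (injective⇒≤ {f = λ i → punchOut (w≢f i)} (λ eq → f-injective (punchOut-injective (w≢f _) (w≢f _) eq)))
  where
  w≢f : ∀ i → ¬ w ≡ f i
  w≢f i w≡fi = missed i (sym w≡fi)

Fin≤1-unique : ∀ {k} → k ≤ 1 → (i j : Fin k) → i ≡ j
Fin≤1-unique {suc zero} _ zero zero = refl
Fin≤1-unique {suc (suc k)} (s≤s ()) _ _

≤1-vertex≼ : ∀ G H → n G ≤ 1 → (h : Fin (n H)) → G ≼ H
≤1-vertex≼ G H n≤1 h = embedding⇒minor G H (λ _ → h) (λ {i} {j} _ → Fin≤1-unique n≤1 i j)
  (λ i j a → ⊥-elim (adj⇒≢ G a (Fin≤1-unique n≤1 i j)))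

K₁ : Graph
K₁ = record { n = 1 ; adj = λ _ _ → false ; adj-sym = λ _ _ → refl ; adj-irrefl = λ _ → refl }

K₂ : Graph
K₂ = DisjointUnion.Bridged.bridged K₁ K₁ zero zero

K₂-complete : ∀ a b → ¬ a ≡ b → adj K₂ a b ≡ true
K₂-complete zero zero a≢b = ⊥-elim (a≢b refl)
K₂-complete zero (suc zero) _ = DisjointUnion.Bridged.bridge-edge K₁ K₁ zero zero
K₂-complete (suc zero) zero _ = trans (adj-sym K₂ (suc zero) zero) (DisjointUnion.Bridged.bridge-edge K₁ K₁ zero zero)
K₂-complete (suc zero) (suc zero) a≢b = ⊥-elim (a≢b refl)

≤2-vertices≼K₂ : ∀ G → n G ≤ 2 → G ≼ K₂
≤2-vertices≼K₂ G n≤2 = embedding⇒minor G K₂ g g-injective (λ i j a → K₂-complete (g i) (g j) (adj⇒≢ G a ∘ g-injective))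
  where
  g : Fin (n G) → Fin 2
  g i = inject≤ i n≤2
  g-injective : Injective _≡_ _≡_ g
  g-injective = inject≤-injective n≤2 n≤2 _ _

module ForestsInClass (A : Class) (minorClosed : MinorClosed A) (addable : Addable A)
                      (G₀ : Graph) (G₀∈A : A G₀) (v₀ : Fin (n G₀)) where

  ≤1-vertex∈A : ∀ G → n G ≤ 1 → A G
  ≤1-vertex∈A G n≤1 = minorClosed G₀ G G₀∈A (≤1-vertex≼ G G₀ n≤1 v₀)

  bridged∈A : ∀ G₁ G₂ x₁ x₂ → A G₁ → A G₂ → A (DisjointUnion.Bridged.bridged G₁ G₂ x₁ x₂)
  bridged∈A G₁ G₂ x₁ x₂ G₁∈A G₂∈A =
    DisjointUnion.Bridged.bridged∈A G₁ G₂ x₁ x₂ A (proj₂ addable) (DisjointUnion.UnionInClass.union∈A G₁ G₂ A minorClosed (proj₁ addable) G₁∈A G₂∈A)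

  K₂∈A : A K₂
  K₂∈A = bridged∈A K₁ K₁ zero zero (≤1-vertex∈A K₁ ≤-refl) (≤1-vertex∈A K₁ ≤-refl)

  cut-vertex∈A : ∀ G (x y z : Fin (n G)) (y≢x : ¬ y ≡ x) (z≢x : ¬ z ≡ x) (y↛z : ¬ Reach G (λ w → ¬ w ≡ x) y z) →
    A (inducedOn G (CutVertexSeparation.left G x y z y≢x z≢x y↛z)) →
    A (inducedOn G (CutVertexSeparation.right G x y z y≢x z≢x y↛z)) → A G
  cut-vertex∈A G x y z y≢x z≢x y↛z Gl∈A Gr∈A =
    minorClosed _ G (bridged∈A Gl Gr (toLeft x) (toRight x) Gl∈A Gr∈A)
      (OneVertexGluing.gluing≼bridged G left right x toLeft toRight cover in-both left-x right-x refl refl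
         (enum⁻¹-injective left) (enum⁻¹-injective right) edges)
    where
    open CutVertexSeparation G x y z y≢x z≢x y↛z
    Gl = inducedOn G left
    Gr = inducedOn G right
    toLeft : Fin (n G) → Fin (n Gl)
    toLeft = enum⁻¹ (n G) left (proj₁ (enum-surjective (n G) left x left-x))
    toRight : Fin (n G) → Fin (n Gr)
    toRight = enum⁻¹ (n G) right (proj₁ (enum-surjective (n G) right x right-x))
    open DisjointUnion.Bridged Gl Gr (toLeft x) (toRight x) using (module OneVertexGluing)
    enum⁻¹-injective : ∀ s {d} u v → s u ≡ true → s v ≡ true → enum⁻¹ (n G) s d u ≡ enum⁻¹ (n G) s d v → u ≡ v
    enum⁻¹-injective s u v su sv eq = trans (sym (enum-enum⁻¹ (n G) s _ u su)) (trans (cong (enum (n G) s) eq) (enum-enum⁻¹ (n G) s _ v sv))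
    cover : ∀ v → (left v ∨ right v) ≡ true
    cover v with reached v
    ... | true = refl
    ... | false = ∨-zeroʳ _
    in-both : ∀ v → left v ≡ true → right v ≡ true → v ≡ x
    in-both v lv rv with reached v | v == x in v==x
    ... | false | true = ==-true v==x
    in-both v () rv | false | false
    in-both v lv () | true | _
    𝟙≡1⇒ : ∀ {b} → 𝟙 b ≡ 1 → b ≡ true
    𝟙≡1⇒ {true} _ = refl
    adj-enum⁻¹ : ∀ s {d} u v → s u ≡ true → s v ≡ true → adj G u v ≡ true → adj (inducedOn G s) (enum⁻¹ (n G) s d u) (enum⁻¹ (n G) s d v) ≡ true
    adj-enum⁻¹ s u v su sv a = trans (cong₂ (adj G) (enum-enum⁻¹ (n G) s _ u su) (enum-enum⁻¹ (n G) s _ v sv)) a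
    edges : ∀ u v → adj G u v ≡ true →
      (left u ≡ true × left v ≡ true × adj Gl (toLeft u) (toLeft v) ≡ true) ⊎ (right u ≡ true × right v ≡ true × adj Gr (toRight u) (toRight v) ≡ true)
    edges u v a with left u ∧ left v in luv | split u v a
    ... | true | _ = inj₁ (lu , lv , adj-enum⁻¹ left u v lu lv a)
      where
      lu = ∧-conicalˡ (left u) (left v) luv
      lv = ∧-conicalʳ (left u) (left v) luv
    ... | false | ruv = inj₂ (ru , rv , adj-enum⁻¹ right u v ru rv a)
      where
      ru = ∧-conicalˡ (right u) (right v) (𝟙≡1⇒ ruv)
      rv = ∧-conicalʳ (right u) (right v) (𝟙≡1⇒ ruv)

  disconnected∈A : ∀ G → Disconnected G → (∀ H → n H < n G → Forest H → A H) → Forest G → A G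
  disconnected∈A G (y , z , y≁z) ih forest = proj₂ (proj₁ addable G) component∈A
    where
    component∈A : ∀ m (f : Fin m → Fin (n G)) → IsComponent G f → A (induced G f)
    component∈A (suc m) f (_ , f-injective , f-connected , _) =
      ih (induced G f) (injective-missing⇒< f f-injective (proj₁ missed) (proj₂ missed)) (forest-induced G f f-injective forest)
      where
      missed : ∃[ w ] (∀ i → ¬ f i ≡ w)
      missed with any? (λ i → f i ≟ y)
      ... | no y∉f = y , λ i fi≡y → y∉f (i , fi≡y)
      ... | yes (i , fi≡y) with any? (λ j → f j ≟ z)
      ... | no z∉f = z , λ j fj≡z → z∉f (j , fj≡z)
      ... | yes (j , fj≡z) = ⊥-elim (y≁z (subst₂ (SameComponent G) fi≡y fj≡z (reach-trans (reach-sym (f-connected zero i)) (f-connected zero j))))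

  forest∈A : ∀ G → Forest G → A G
  forest∈A = size-induction (λ G → Forest G → A G) inductive-step
    where
    inductive-step : ∀ G → (∀ H → n H < n G → Forest H → A H) → Forest G → A G
    inductive-step G ih forest with n G ≤? 2
    ... | yes n≤2 = minorClosed K₂ G K₂∈A (≤2-vertices≼K₂ G n≤2)
    ... | no 2≮n with twoConnected-or-separable G (≰⇒> 2≮n)
    ... | inj₁ tc = ⊥-elim (forest (twoConnected⇒cycle G tc))
    ... | inj₂ (inj₁ disconnected) = disconnected∈A G disconnected ih forest
    ... | inj₂ (inj₂ (_ , x , y , z , y≢x , z≢x , y↛z)) =
      cut-vertex∈A G x y z y≢x z≢x y↛z (ih _ (left< separation) (forest-induced G _ (enum-injective (n G) left) forest))
                                       (ih _ (right< separation) (forest-induced G _ (enum-injective (n G) right) forest))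
      where open CutVertexSeparation G x y z y≢x z≢x y↛z

graphOn : (m : ℕ) (a : Fin (suc m) → Fin (suc m) → Bool) → (∀ i j → a i j ≡ a j i) → (∀ i → a i i ≡ false) → Graph
graphOn m a s r = record { n = suc m ; adj = a ; adj-sym = s ; adj-irrefl = r }

module OneSum (G1 : Graph) (x1 : Fin (n G1)) (m : ℕ) (a2 : Fin (suc m) → Fin (suc m) → Bool)
  (s2 : ∀ i j → a2 i j ≡ a2 j i) (r2 : ∀ i → a2 i i ≡ false) (x2 : Fin (suc m)) where

  G2 = graphOn m a2 s2 r2
  n1 = n G1
  skip : Fin m → Fin (suc m)
  skip = punchIn x2

  adj⊕ : Fin n1 ⊎ Fin m → Fin n1 ⊎ Fin m → Bool
  adj⊕ (inj₁ a) (inj₁ b) = adj G1 a b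
  adj⊕ (inj₂ j) (inj₂ j') = a2 (skip j) (skip j')
  adj⊕ (inj₁ a) (inj₂ j) = (a == x1) ∧ a2 x2 (skip j)
  adj⊕ (inj₂ j) (inj₁ a) = (a == x1) ∧ a2 (skip j) x2

  adj⊕-sym : ∀ u v → adj⊕ u v ≡ adj⊕ v u
  adj⊕-sym (inj₁ a) (inj₁ b) = adj-sym G1 a b
  adj⊕-sym (inj₂ j) (inj₂ j') = s2 _ _
  adj⊕-sym (inj₁ a) (inj₂ j) = cong ((a == x1) ∧_) (s2 _ _)
  adj⊕-sym (inj₂ j) (inj₁ a) = cong ((a == x1) ∧_) (s2 _ _)

  adj⊕-irrefl : ∀ u → adj⊕ u u ≡ false
  adj⊕-irrefl (inj₁ a) = adj-irrefl G1 a
  adj⊕-irrefl (inj₂ j) = r2 _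

  glued : Graph
  glued = record { n = n1 + m ; adj = λ u v → adj⊕ (splitAt n1 u) (splitAt n1 v)
             ; adj-sym = λ u v → adj⊕-sym (splitAt n1 u) (splitAt n1 v)
             ; adj-irrefl = λ u → adj⊕-irrefl (splitAt n1 u) }

  inl : Fin n1 → Fin (n1 + m)
  inl a = a ↑ˡ m
  inr : Fin m → Fin (n1 + m)
  inr j = n1 ↑ʳ j
  x₁ = inl x1

  inl-or-inr : ∀ v → (∃[ a ] v ≡ inl a) ⊎ (∃[ j ] v ≡ inr j)
  inl-or-inr v with splitAt n1 v in e
  ... | inj₁ a = inj₁ (a , sym (splitAt⁻¹-↑ˡ e))
  ... | inj₂ j = inj₂ (j , sym (splitAt⁻¹-↑ʳ e))

  splitAt-inl : ∀ a → splitAt n1 (inl a) ≡ inj₁ a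
  splitAt-inl a = splitAt-↑ˡ n1 a m
  splitAt-inr : ∀ j → splitAt n1 (inr j) ≡ inj₂ j
  splitAt-inr j = splitAt-↑ʳ n1 m j

  adj-inl-inl : ∀ a b → adj glued (inl a) (inl b) ≡ adj G1 a b
  adj-inl-inl a b rewrite splitAt-inl a | splitAt-inl b = refl
  adj-inr-inr : ∀ j j' → adj glued (inr j) (inr j') ≡ a2 (skip j) (skip j')
  adj-inr-inr j j' rewrite splitAt-inr j | splitAt-inr j' = refl
  adj-inl-inr : ∀ a j → adj glued (inl a) (inr j) ≡ (a == x1) ∧ a2 x2 (skip j)
  adj-inl-inr a j rewrite splitAt-inl a | splitAt-inr j = refl
  adj-inr-inl : ∀ j a → adj glued (inr j) (inl a) ≡ (a == x1) ∧ a2 (skip j) x2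
  adj-inr-inl j a rewrite splitAt-inl a | splitAt-inr j = refl

  inl≢inr : ∀ {a j} → ¬ inl a ≡ inr j
  inl≢inr {a} {j} e with trans (sym (splitAt-inl a)) (trans (cong (splitAt n1) e) (splitAt-inr j))
  ... | ()

  isInl : Fin (n1 + m) → Bool
  isInl v with splitAt n1 v
  ... | inj₁ _ = true
  ... | inj₂ _ = false

  isInl-inl : ∀ a → isInl (inl a) ≡ true
  isInl-inl a rewrite splitAt-inl a = refl
  isInl-inr : ∀ j → isInl (inr j) ≡ false
  isInl-inr j rewrite splitAt-inr j = refl

  inG1 inG2 : Fin (n1 + m) → Bool
  inG1 v = isInl v ∨ (v == x₁)
  inG2 v = not (isInl v) ∨ (v == x₁)

  toG1 : Fin (n1 + m) → Fin n1
  toG1 v with splitAt n1 v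
  ... | inj₁ a = a
  ... | inj₂ _ = x1
  toG2 : Fin (n1 + m) → Fin (suc m)
  toG2 v with splitAt n1 v
  ... | inj₁ _ = x2
  ... | inj₂ j = skip j

  toG1-inl : ∀ a → toG1 (inl a) ≡ a
  toG1-inl a rewrite splitAt-inl a = refl
  toG2-inl : ∀ a → toG2 (inl a) ≡ x2
  toG2-inl a rewrite splitAt-inl a = refl
  toG2-inr : ∀ j → toG2 (inr j) ≡ skip j
  toG2-inr j rewrite splitAt-inr j = refl

  inG1-inl : ∀ a → inG1 (inl a) ≡ true
  inG1-inl a rewrite isInl-inl a = refl
  inG2-inr : ∀ j → inG2 (inr j) ≡ true
  inG2-inr j rewrite isInl-inr j = refl
  inG2-x₁ : inG2 x₁ ≡ true
  inG2-x₁ rewrite ==-refl x₁ = ∨-zeroʳ _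
  inG1-inr : ∀ j → inG1 (inr j) ≡ false
  inG1-inr j rewrite isInl-inr j = ==-false (λ e → inl≢inr (sym e))
  inG2-inl : ∀ a → ¬ a ≡ x1 → inG2 (inl a) ≡ false
  inG2-inl a ne rewrite isInl-inl a = ==-false (λ e → ne (↑ˡ-injective m a x1 e))

  cover : ∀ v → (inG1 v ∨ inG2 v) ≡ true
  cover v with inl-or-inr v
  ... | inj₁ (a , refl) rewrite inG1-inl a = refl
  ... | inj₂ (j , refl) rewrite inG2-inr j = ∨-zeroʳ _

  in-both : ∀ v → inG1 v ≡ true → inG2 v ≡ true → v ≡ x₁
  in-both v p1 p2 with inl-or-inr v
  ... | inj₂ (j , refl) rewrite inG1-inr j with p1
  ... | ()
  in-both v p1 p2 | inj₁ (a , refl) with a ≟ x1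
  ... | yes refl = refl
  ... | no ne rewrite inG2-inl a ne with p2
  ... | ()

  toG1-injective : ∀ u v → inG1 u ≡ true → inG1 v ≡ true → toG1 u ≡ toG1 v → u ≡ v
  toG1-injective u v pu pv e with inl-or-inr u | inl-or-inr v
  ... | inj₂ (j , refl) | _ rewrite inG1-inr j with pu
  ... | ()
  toG1-injective u v pu pv e | inj₁ _ | inj₂ (j , refl) rewrite inG1-inr j with pv
  ... | ()
  toG1-injective u v pu pv e | inj₁ (a , refl) | inj₁ (b , refl) = cong inl (trans (sym (toG1-inl a)) (trans e (toG1-inl b)))

  toG2-injective : ∀ u v → inG2 u ≡ true → inG2 v ≡ true → toG2 u ≡ toG2 v → u ≡ v
  toG2-injective u v pu pv e with inl-or-inr u | inl-or-inr v
  ... | inj₁ (a , refl) | inj₁ (b , refl) = trans (in-both _ (inG1-inl a) pu) (sym (in-both _ (inG1-inl b) pv))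
  ... | inj₂ (j , refl) | inj₂ (j' , refl) = cong inr (punchIn-injective x2 j j' (trans (sym (toG2-inr j)) (trans e (toG2-inr j'))))
  ... | inj₁ (a , refl) | inj₂ (j , refl) = ⊥-elim (punchInᵢ≢i x2 j (trans (sym (toG2-inr j)) (trans (sym e) (toG2-inl a))))
  ... | inj₂ (j , refl) | inj₁ (a , refl) = ⊥-elim (punchInᵢ≢i x2 j (trans (sym (toG2-inr j)) (trans e (toG2-inl a))))

  edges : ∀ u v → adj glued u v ≡ true →
         (inG1 u ≡ true × inG1 v ≡ true × adj G1 (toG1 u) (toG1 v) ≡ true) ⊎ (inG2 u ≡ true × inG2 v ≡ true × a2 (toG2 u) (toG2 v) ≡ true)
  edges u v addable with inl-or-inr u | inl-or-inr v
  ... | inj₁ (a , refl) | inj₁ (b , refl) = inj₁ (inG1-inl a , inG1-inl b , trans (cong₂ (adj G1) (toG1-inl a) (toG1-inl b)) (trans (sym (adj-inl-inl a b)) addable))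
  ... | inj₂ (j , refl) | inj₂ (j' , refl) = inj₂ (inG2-inr j , inG2-inr j' , trans (cong₂ a2 (toG2-inr j) (toG2-inr j')) (trans (sym (adj-inr-inr j j')) addable))
  ... | inj₁ (a , refl) | inj₂ (j , refl) with ==-true {i = a} {j = x1} (∧-conicalˡ _ _ (trans (sym (adj-inl-inr a j)) addable))
  ... | refl = inj₂ (inG2-x₁ , inG2-inr j , trans (cong₂ a2 (toG2-inl a) (toG2-inr j)) (∧-conicalʳ _ _ (trans (sym (adj-inl-inr a j)) addable)))
  edges u v addable | inj₂ (j , refl) | inj₁ (a , refl) with ==-true {i = a} {j = x1} (∧-conicalˡ _ _ (trans (sym (adj-inr-inl j a)) addable))
  ... | refl = inj₂ (inG2-inr j , inG2-x₁ , trans (cong₂ a2 (toG2-inr j) (toG2-inl a)) (∧-conicalʳ _ _ (trans (sym (adj-inr-inl j a)) addable)))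

  glued≼bridged : glued ≼ DisjointUnion.Bridged.bridged G1 G2 x1 x2
  glued≼bridged = DisjointUnion.Bridged.OneVertexGluing.gluing≼bridged G1 G2 x1 x2 glued inG1 inG2 x₁ toG1 toG2 cover in-both (inG1-inl x1) inG2-x₁ (toG1-inl x1) (toG2-inl x1) toG1-injective toG2-injective edges

  oneSum∈A : (A : Class) → MinorClosed A → Addable A → A G1 → A G2 → A glued
  oneSum∈A A minorClosed addable G1∈A G2∈A = minorClosed _ glued (DisjointUnion.Bridged.bridged∈A G1 G2 x1 x2 A (proj₂ addable) (DisjointUnion.UnionInClass.union∈A G1 G2 A minorClosed (proj₁ addable) G1∈A G2∈A)) glued≼bridged

  inl≢x₁ : ∀ a → ¬ a ≡ x1 → (inl a == x₁) ≡ false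
  inl≢x₁ a ne = ==-false (λ e → ne (↑ˡ-injective m a x1 e))

  edges-split : ∀ u v → adj glued u v ≡ true → 𝟙 (isInl u ∧ isInl v) + 𝟙 (inG2 u ∧ inG2 v) ≡ 1
  edges-split u v addable with inl-or-inr u | inl-or-inr v
  ... | inj₂ (j , refl) | inj₂ (j' , refl) rewrite isInl-inr j | isInl-inr j' = refl
  ... | inj₁ (a , refl) | inj₂ (j , refl) with ==-true {i = a} {j = x1} (∧-conicalˡ _ _ (trans (sym (adj-inl-inr a j)) addable))
  ... | refl rewrite isInl-inl x1 | isInl-inr j | ==-refl x₁ = refl
  edges-split u v addable | inj₂ (j , refl) | inj₁ (a , refl) with ==-true {i = a} {j = x1} (∧-conicalˡ _ _ (trans (sym (adj-inr-inl j a)) addable))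
  ... | refl rewrite isInl-inl x1 | isInl-inr j | ==-refl x₁ = refl
  edges-split u v addable | inj₁ (a , refl) | inj₁ (b , refl) with a ≟ x1
  ... | no ne rewrite isInl-inl a | isInl-inl b | inl≢x₁ a ne = refl
  ... | yes refl with b ≟ x1
  ... | no ne rewrite isInl-inl x1 | isInl-inl b | inl≢x₁ b ne with inl x1 == x₁
  ... | true = refl
  ... | false = refl
  edges-split u v addable | inj₁ (a , refl) | inj₁ (b , refl) | yes refl | yes refl with trans (sym addable) (adj-irrefl glued (inl x1))
  ... | ()

  punchIn-view : ∀ y → (y ≡ x2) ⊎ (∃[ j ] y ≡ skip j)
  punchIn-view y with x2 ≟ y
  ... | yes e = inj₁ (sym e)
  ... | no ne = inj₂ (punchOut ne , sym (punchIn-punchOut ne))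

  fromG2 : Fin (suc m) → Fin (n1 + m)
  fromG2 y with x2 ≟ y
  ... | yes _ = x₁
  ... | no ne = inr (punchOut ne)

  fromG2-x2 : fromG2 x2 ≡ x₁
  fromG2-x2 with x2 ≟ x2
  ... | yes _ = refl
  ... | no ne = ⊥-elim (ne refl)

  fromG2-skip : ∀ j → fromG2 (skip j) ≡ inr j
  fromG2-skip j with x2 ≟ skip j
  ... | yes e = ⊥-elim (punchInᵢ≢i x2 j (sym e))
  ... | no ne = cong inr (trans (punchOut-cong x2 refl) (punchOut-punchIn x2))

  fromG2-injective : Injective _≡_ _≡_ fromG2
  fromG2-injective {y} {y'} e with punchIn-view y | punchIn-view y'
  ... | inj₁ refl | inj₁ refl = refl
  ... | inj₂ (j , refl) | inj₂ (j' , refl) = cong skip (↑ʳ-injective n1 j j' (trans (sym (fromG2-skip j)) (trans e (fromG2-skip j'))))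
  ... | inj₁ refl | inj₂ (j , refl) = ⊥-elim (inl≢inr (trans (sym fromG2-x2) (trans e (fromG2-skip j))))
  ... | inj₂ (j , refl) | inj₁ refl = ⊥-elim (inl≢inr (trans (sym fromG2-x2) (trans (sym e) (fromG2-skip j))))

  fromG2-onto : ∀ v → inG2 v ≡ true → ∃[ y ] fromG2 y ≡ v
  fromG2-onto v q with inl-or-inr v
  ... | inj₂ (j , refl) = skip j , fromG2-skip j
  ... | inj₁ (a , refl) with a ≟ x1
  ... | yes refl = x2 , fromG2-x2
  ... | no ne rewrite inG2-inl a ne with q
  ... | ()

  fromG2-inG2 : ∀ y → inG2 (fromG2 y) ≡ true
  fromG2-inG2 y with punchIn-view y
  ... | inj₁ refl rewrite fromG2-x2 = inG2-x₁
  ... | inj₂ (j , refl) rewrite fromG2-skip j = inG2-inr j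

  adj-fromG2 : ∀ y y' → a2 y y' ≡ adj glued (fromG2 y) (fromG2 y')
  adj-fromG2 y y' with punchIn-view y | punchIn-view y'
  ... | inj₁ refl | inj₁ refl rewrite fromG2-x2 = trans (r2 x2) (sym (adj-irrefl glued x₁))
  ... | inj₁ refl | inj₂ (j , refl) rewrite fromG2-x2 | fromG2-skip j | adj-inl-inr x1 j | ==-refl x1 = refl
  ... | inj₂ (j , refl) | inj₁ refl rewrite fromG2-x2 | fromG2-skip j | adj-inr-inl j x1 | ==-refl x1 = refl
  ... | inj₂ (j , refl) | inj₂ (j' , refl) rewrite fromG2-skip j | fromG2-skip j' = sym (adj-inr-inr j j')

  inl-onto : ∀ v → isInl v ≡ true → ∃[ a ] inl a ≡ v
  inl-onto v q with inl-or-inr v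
  ... | inj₁ (a , refl) = a , refl
  ... | inj₂ (j , refl) rewrite isInl-inr j with q
  ... | ()

  degreeSum-oneSum : degreeSum glued ≡ degreeSum G1 + degreeSum G2
  degreeSum-oneSum = sym (trans (cong₂ _+_ (degreeSum-embedding G1 glued inl (↑ˡ-injective m _ _) isInl inl-onto isInl-inl (λ a b → sym (adj-inl-inl a b)))
                            (degreeSum-embedding G2 glued fromG2 fromG2-injective inG2 fromG2-onto fromG2-inG2 adj-fromG2))
                   (degreeSum-split glued isInl inG2 edges-split))

  e-oneSum : e glued ≡ e G1 + e G2
  e-oneSum = m+m≡n+n⇒m≡n (begin
      e glued + e glued
    ≡⟨ sym (handshake glued) ⟩
      degreeSum glued
    ≡⟨ degreeSum-oneSum ⟩
      degreeSum G1 + degreeSum G2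
    ≡⟨ cong₂ _+_ (handshake G1) (handshake G2) ⟩
      (e G1 + e G1) + (e G2 + e G2)
    ≡⟨ +-interchange (e G1) (e G1) (e G2) (e G2) ⟩
      (e G1 + e G2) + (e G1 + e G2)
    ∎)
    where open ≡-Reasoning

_/1+_ : ℕ → ℕ → ℚ
x /1+ y = (ℤ.+ x) ÷ suc y

toℚᵘ-/1+ : ∀ x y → toℚᵘ (x /1+ y) U.≃ mkℚᵘ (ℤ.+ x) y
toℚᵘ-/1+ x y = toℚᵘ-fromℚᵘ (mkℚᵘ (ℤ.+ x) y)

toℚᵘ-mkℚ : ∀ q → toℚᵘ q ≡ mkℚᵘ (↥ q) (ℚ.denominator-1 q)
toℚᵘ-mkℚ (mkℚ _ _ _) = refl

/1+-mono-≤ : ∀ {x y x' y'} → x * suc y' ≤ x' * suc y → x /1+ y ℚ.≤ x' /1+ y'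
/1+-mono-≤ {x} {y} {x'} {y'} h = toℚᵘ-cancel-≤ (UP.≤-respʳ-≃ (UP.≃-sym (toℚᵘ-/1+ x' y')) (UP.≤-respˡ-≃ (UP.≃-sym (toℚᵘ-/1+ x y))
  (*≤* (subst₂ ℤ._≤_ (ℤP.pos-* x (suc y')) (ℤP.pos-* x' (suc y)) (+≤+ h)))))

/1+-cong : ∀ {x y x' y'} → x * suc y' ≡ x' * suc y → x /1+ y ≡ x' /1+ y'
/1+-cong {x} {y} {x'} {y'} h = fromℚᵘ-cong {mkℚᵘ (ℤ.+ x) y} {mkℚᵘ (ℤ.+ x') y'}
  (*≡* (trans (sym (ℤP.pos-* x (suc y'))) (trans (cong ℤ.+_ h) (ℤP.pos-* x' (suc y)))))

1+k/1+k≡1 : ∀ k → suc k /1+ k ≡ 1ℚ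
1+k/1+k≡1 k = /1+-cong {suc k} {k} {1} {0} (trans (*-identityʳ (suc k)) (sym (+-identityʳ (suc k))))

/1+≤-cross : ∀ {x y} q → x /1+ y ℚ.≤ q → ℤ.+ x ℤ.* ℤ.+ ↧ₙ q ℤ.≤ ↥ q ℤ.* ℤ.+ suc y
/1+≤-cross {x} {y} q h with UP.≤-respˡ-≃ (toℚᵘ-/1+ x y) (subst (toℚᵘ (x /1+ y) U.≤_) (toℚᵘ-mkℚ q) (toℚᵘ-mono-≤ h))
... | *≤* h' = h'

/1+≤⁺ : ∀ {x y a} q → ↥ q ≡ ℤ.+ a → x * ↧ₙ q ≤ a * suc y → x /1+ y ℚ.≤ q
/1+≤⁺ {x} {y} {a} q ↥q≡a h = toℚᵘ-cancel-≤ (subst (toℚᵘ (x /1+ y) U.≤_) (sym (toℚᵘ-mkℚ q)) (UP.≤-respˡ-≃ (UP.≃-sym (toℚᵘ-/1+ x y))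
  (*≤* (subst₂ ℤ._≤_ (ℤP.pos-* x (↧ₙ q)) (trans (ℤP.pos-* a (suc y)) (cong (ℤ._* ℤ.+ suc y) (sym ↥q≡a))) (+≤+ h)))))

/1+≤⁻ : ∀ {x y a} q → ↥ q ≡ ℤ.+ a → x /1+ y ℚ.≤ q → x * ↧ₙ q ≤ a * suc y
/1+≤⁻ {x} {y} {a} q ↥q≡a h = ℤP.drop‿+≤+ (subst₂ ℤ._≤_ (sym (ℤP.pos-* x (↧ₙ q))) (trans (cong (ℤ._* ℤ.+ suc y) ↥q≡a) (sym (ℤP.pos-* a (suc y))))
  (/1+≤-cross {x} {y} q h))

<-/1+⁺ : ∀ {x y} q → ↥ q ℤ.* ℤ.+ suc y ℤ.< ℤ.+ x ℤ.* ℤ.+ ↧ₙ q → q ℚ.< x /1+ y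
<-/1+⁺ {x} {y} q h = toℚᵘ-cancel-< (subst (U._< toℚᵘ (x /1+ y)) (sym (toℚᵘ-mkℚ q)) (UP.<-respʳ-≃ (UP.≃-sym (toℚᵘ-/1+ x y)) (*<* h)))

<-/1+⁻ : ∀ {x y} q → q ℚ.< x /1+ y → ↥ q ℤ.* ℤ.+ suc y ℤ.< ℤ.+ x ℤ.* ℤ.+ ↧ₙ q
<-/1+⁻ {x} {y} q h with UP.<-respʳ-≃ (toℚᵘ-/1+ x y) (subst (U._< toℚᵘ (x /1+ y)) (toℚᵘ-mkℚ q) (toℚᵘ-mono-< h))
... | *<* h' = h'

densityOf : ℕ → ℕ → ℚ
densityOf zero _ = 0ℚ
densityOf (suc k) m = m /1+ k

ρ₁Of : ℕ → ℕ → ℚ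
ρ₁Of zero _ = 0ℚ
ρ₁Of (suc zero) _ = 0ℚ
ρ₁Of (suc (suc k)) zero = 0ℚ
ρ₁Of (suc (suc k)) (suc m) = suc m /1+ k

density≡densityOf : ∀ G → density G ≡ densityOf (n G) (e G)
density≡densityOf record { n = zero } = refl
density≡densityOf record { n = suc k } = refl

ρ₁≡ρ₁Of : ∀ G → ρ₁ G ≡ ρ₁Of (n G) (e G)
ρ₁≡ρ₁Of record { n = k ; adj = a ; adj-sym = s ; adj-irrefl = r } = by-size k a s r _ refl
  where
  by-size : ∀ k (a : Fin k → Fin k → Bool) s r m → e (record { n = k ; adj = a ; adj-sym = s ; adj-irrefl = r }) ≡ m →
    ρ₁ (record { n = k ; adj = a ; adj-sym = s ; adj-irrefl = r }) ≡ ρ₁Of k m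
  by-size zero a s r m _ = refl
  by-size (suc zero) a s r m _ = refl
  by-size (suc (suc k)) a s r m eq with e (record { n = suc (suc k) ; adj = a ; adj-sym = s ; adj-irrefl = r })
  by-size (suc (suc k)) a s r .zero refl | zero = refl
  by-size (suc (suc k)) a s r .(suc m) refl | suc m = refl

e≡0-≤1 : ∀ G → n G ≤ 1 → e G ≡ 0
e≡0-≤1 G n≤1 = n≤0⇒n≡0 (≤-trans (e-small G (≤-trans n≤1 (n≤1+n 1))) (∸-monoˡ-≤ 1 n≤1))

density≤ρ₁ : ∀ G → density G ℚ.≤ ρ₁ G
density≤ρ₁ G rewrite density≡densityOf G | ρ₁≡ρ₁Of G = by-size (n G) (e G) (e≡0-≤1 G)
  where
  by-size : ∀ k m → (k ≤ 1 → m ≡ 0) → densityOf k m ℚ.≤ ρ₁Of k m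
  by-size zero m _ = ℚP.≤-refl
  by-size (suc zero) m small rewrite small (s≤s z≤n) = ℚP.≤-refl
  by-size (suc (suc k)) zero _ = /1+-mono-≤ {0} {suc k} {0} {0} z≤n
  by-size (suc (suc k)) (suc m) _ = /1+-mono-≤ {suc m} {suc k} {suc m} {k} (*-monoʳ-≤ (suc m) (n≤1+n (suc k)))

0≤density : ∀ G → 0ℚ ℚ.≤ density G
0≤density G rewrite density≡densityOf G = by-size (n G) (e G)
  where
  by-size : ∀ k m → 0ℚ ℚ.≤ densityOf k m
  by-size zero m = ℚP.≤-refl
  by-size (suc k) m = /1+-mono-≤ {0} {0} {m} {k} z≤n

module Reindex (G : Graph) (m : ℕ) (n≡1+m : n G ≡ suc m) where
  cast : Fin (suc m) → Fin (n G)
  cast = subst Fin (sym n≡1+m)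

  uncast : Fin (n G) → Fin (suc m)
  uncast = subst Fin n≡1+m

  cast-injective : Injective _≡_ _≡_ cast
  cast-injective {i} {j} p = trans (sym (subst-subst-sym n≡1+m)) (trans (cong uncast p) (subst-subst-sym n≡1+m))

  adj′ : Fin (suc m) → Fin (suc m) → Bool
  adj′ i j = adj G (cast i) (cast j)

  adj′-sym : ∀ i j → adj′ i j ≡ adj′ j i
  adj′-sym i j = adj-sym G (cast i) (cast j)

  adj′-irrefl : ∀ i → adj′ i i ≡ false
  adj′-irrefl i = adj-irrefl G (cast i)

  G′ : Graph
  G′ = graphOn m adj′ adj′-sym adj′-irrefl

  G′≼G : G′ ≼ G
  G′≼G = embedding⇒minor G′ G cast cast-injective (λ i j a → a)

  e-G′ : e G′ ≡ e G
  e-G′ = m+m≡n+n⇒m≡n (trans (sym (handshake G′)) (trans (degreeSum-embedding G′ G cast cast-injective (λ _ → true)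
           (λ u _ → uncast u , subst-sym-subst n≡1+m) (λ _ → refl) (λ i j → refl)) (handshake G)))

module Copies (m : ℕ) (a : Fin (suc m) → Fin (suc m) → Bool)
              (a-sym : ∀ i j → a i j ≡ a j i) (a-irrefl : ∀ i → a i i ≡ false) where

  H : Graph
  H = graphOn m a a-sym a-irrefl

  copies : ℕ → Σ Graph (λ C → Fin (n C))
  copies zero = K₁ , zero
  copies (suc t) = OneSum.glued (proj₁ (copies t)) (proj₂ (copies t)) m a a-sym a-irrefl zero , (proj₂ (copies t) ↑ˡ m)

  n-copies : ∀ t → n (proj₁ (copies t)) ≡ suc (t * m)
  n-copies zero = refl
  n-copies (suc t) = trans (cong (_+ m) (n-copies t)) (cong suc (+-comm (t * m) m))

  e-copies : ∀ t → e (proj₁ (copies t)) ≡ t * e H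
  e-copies zero = refl
  e-copies (suc t) = trans (OneSum.e-oneSum (proj₁ (copies t)) (proj₂ (copies t)) m a a-sym a-irrefl zero)
                       (trans (cong (_+ e H) (e-copies t)) (+-comm (t * e H) (e H)))

  density-copies : ∀ t → density (proj₁ (copies t)) ≡ (t * e H) /1+ (t * m)
  density-copies t = trans (density≡densityOf (proj₁ (copies t)))
    (trans (cong (λ k → densityOf k (e (proj₁ (copies t)))) (n-copies t)) (cong (_/1+ (t * m)) (e-copies t)))

  copies∈A : ∀ (A : Class) → MinorClosed A → Addable A → A K₁ → A H → ∀ t → A (proj₁ (copies t))
  copies∈A A minorClosed addable K₁∈A H∈A zero = K₁∈A
  copies∈A A minorClosed addable K₁∈A H∈A (suc t) = OneSum.oneSum∈A (proj₁ (copies t)) (proj₂ (copies t)) m a a-sym a-irrefl zero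
    A minorClosed addable (copies∈A A minorClosed addable K₁∈A H∈A t) H∈A

copies-beat : ∀ N K E D → N * K < E * D → N * suc (suc N * K) < (suc N * E) * D
copies-beat N K E D h = begin-strict
    N * suc (t * K)
  ≡⟨ *-suc N (t * K) ⟩
    N + N * (t * K)
  <⟨ +-monoˡ-< (N * (t * K)) (n<1+n N) ⟩
    t + N * (t * K)
  ≡⟨ cong (t +_) (*-x∙yz≈y∙xz N t K) ⟩
    t + t * (N * K)
  ≡⟨ sym (*-suc t (N * K)) ⟩
    t * suc (N * K)
  ≤⟨ *-monoʳ-≤ t h ⟩
    t * (E * D)
  ≡⟨ sym (*-assoc t E D) ⟩
    t * E * D
  ∎
  where
  open ≤-Reasoning
  t = suc N

module Amplification (A : Class) (minorClosed : MinorClosed A) (addable : Addable A)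
                     (G₀ : Graph) (G₀∈A : A G₀) (v₀ : Fin (n G₀)) where
  open ForestsInClass A minorClosed addable G₀ G₀∈A v₀ using (≤1-vertex∈A)

  nonpositive<density : ∀ q G k m → n G ≡ suc (suc k) → e G ≡ suc m → (↥ q ≡ ℤ.+ 0 ⊎ ∃[ a ] ↥ q ≡ -[1+ a ]) → q ℚ.< density G
  nonpositive<density q G k m n≡ e≡ q≤0 = subst (q ℚ.<_) (sym density-G) (<-/1+⁺ {suc m} {suc k} q (cross q≤0))
    where
    density-G : density G ≡ suc m /1+ suc k
    density-G = trans (density≡densityOf G) (cong₂ densityOf n≡ e≡)
    cross : (↥ q ≡ ℤ.+ 0 ⊎ ∃[ a ] ↥ q ≡ -[1+ a ]) → ↥ q ℤ.* ℤ.+ suc (suc k) ℤ.< ℤ.+ suc m ℤ.* ℤ.+ ↧ₙ q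
    cross (inj₁ ↥q≡0) rewrite ↥q≡0 = +<+ (s≤s z≤n)
    cross (inj₂ (a , ↥q≡-)) rewrite ↥q≡- = -<+

  -- For q = (N + 1)/d < (m + 1)/(k + 1), already N + 2 copies have density above q.
  many-copies : ∀ q G N k m → A G → n G ≡ suc (suc k) → e G ≡ suc m → ↥ q ≡ ℤ.+ suc N →
    q ℚ.< suc m /1+ k → ∃[ H ] (A H × q ℚ.< density H)
  many-copies q G N k m G∈A n≡ e≡ ↥q q<ρ₁ =
    proj₁ (copies t) , copies∈A A minorClosed addable (≤1-vertex∈A K₁ ≤-refl) (minorClosed G G′ G∈A G′≼G) t ,
    subst (q ℚ.<_) (sym density-t) (<-/1+⁺ {t * m₁} {t * k₁} q beat)
    where
    open Reindex G (suc k) n≡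
    open Copies (suc k) adj′ adj′-sym adj′-irrefl
    t = suc (suc N)
    m₁ = suc m
    k₁ = suc k
    density-t : density (proj₁ (copies t)) ≡ (t * m₁) /1+ (t * k₁)
    density-t = trans (density-copies t) (cong (λ z → (t * z) /1+ (t * k₁)) (trans e-G′ e≡))
    q<E/K : suc N * k₁ < m₁ * ↧ₙ q
    q<E/K = ℤP.drop‿+<+ (subst₂ ℤ._<_ (trans (cong (ℤ._* ℤ.+ k₁) ↥q) (sym (ℤP.pos-* (suc N) k₁))) (sym (ℤP.pos-* m₁ (↧ₙ q)))
                          (<-/1+⁻ {suc m} {k} q q<ρ₁))
    beat : ↥ q ℤ.* ℤ.+ suc (t * k₁) ℤ.< ℤ.+ (t * m₁) ℤ.* ℤ.+ ↧ₙ q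
    beat = subst₂ ℤ._<_ (trans (ℤP.pos-* (suc N) (suc (t * k₁))) (cong (ℤ._* ℤ.+ suc (t * k₁)) (sym ↥q))) (ℤP.pos-* (t * m₁) (↧ₙ q))
             (+<+ (copies-beat (suc N) k₁ m₁ (↧ₙ q) q<E/K))

  <ρ₁⇒<density : ∀ q G → A G → q ℚ.< ρ₁ G → ∃[ H ] (A H × q ℚ.< density H)
  <ρ₁⇒<density q G G∈A q<ρ₁ = by-size (n G) (e G) refl refl (subst (q ℚ.<_) (ρ₁≡ρ₁Of G) q<ρ₁)
    where
    by-size : ∀ k m → n G ≡ k → e G ≡ m → q ℚ.< ρ₁Of k m → ∃[ H ] (A H × q ℚ.< density H)
    by-size zero m _ _ q<0 = G , G∈A , ℚP.<-≤-trans q<0 (0≤density G)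
    by-size (suc zero) m _ _ q<0 = G , G∈A , ℚP.<-≤-trans q<0 (0≤density G)
    by-size (suc (suc k)) zero _ _ q<0 = G , G∈A , ℚP.<-≤-trans q<0 (0≤density G)
    by-size (suc (suc k)) (suc m) n≡ e≡ q<ρ₁ with ↥ q in ↥q
    ... | ℤ.+ zero = G , G∈A , nonpositive<density q G k m n≡ e≡ (inj₁ ↥q)
    ... | -[1+ a ] = G , G∈A , nonpositive<density q G k m n≡ e≡ (inj₂ (a , ↥q))
    ... | ℤ.+ suc N = many-copies q G N k m G∈A n≡ e≡ ↥q q<ρ₁

  density-bound⇒ρ₁-bound : ∀ q → UpperBound A density q → UpperBound A ρ₁ q
  density-bound⇒ρ₁-bound q bound G G∈A with ρ₁ G ℚP.≤? q
  ... | yes ρ₁≤q = ρ₁≤q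
  ... | no ρ₁≰q with <ρ₁⇒<density q G G∈A (ℚP.≰⇒> ρ₁≰q)
  ... | H , H∈A , q<density = ⊥-elim (ℚP.<-irrefl refl (ℚP.<-≤-trans q<density (bound H H∈A)))

ρ₁-bound⇒density-bound : ∀ (A : Graph → Set) q → UpperBound A ρ₁ q → UpperBound A density q
ρ₁-bound⇒density-bound A q bound G G∈A = ℚP.≤-trans (density≤ρ₁ G) (bound G G∈A)

K₃-twoConnected : TwoConnected (K 3)
K₃-twoConnected = ≤-refl , (λ x y → any-two x y tt tt) , (λ z x y → any-two x y)
  where
  any-two : ∀ {P : Fin 3 → Set} x y → P x → P y → Reach (K 3) P x y
  any-two x y px py with x ≟ y
  ... | yes refl = here px
  ... | no x≢y = reach-edge px py (cong not (==-false x≢y))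

e≤n∸1⇒density≤1 : ∀ G → e G ≤ n G ∸ 1 → density G ℚ.≤ 1ℚ
e≤n∸1⇒density≤1 G e≤ rewrite density≡densityOf G = by-size (n G) (e G) e≤
  where
  by-size : ∀ k m → m ≤ k ∸ 1 → densityOf k m ℚ.≤ 1ℚ
  by-size zero m _ = /1+-mono-≤ {0} {0} {1} {0} z≤n
  by-size (suc k) m m≤k = /1+-mono-≤ {m} {k} {1} {0} (subst₂ _≤_ (sym (*-identityʳ m)) (sym (*-identityˡ (suc k))) (≤-trans m≤k (n≤1+n k)))

e≡n∸1⇒ρ₁≡1 : ∀ G → e G ≡ n G ∸ 1 → 1 ≤ e G → ρ₁ G ≡ 1ℚ
e≡n∸1⇒ρ₁≡1 G e≡ 1≤e = trans (ρ₁≡ρ₁Of G) (by-size (n G) (e G) e≡ 1≤e)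
  where
  by-size : ∀ k m → m ≡ k ∸ 1 → 1 ≤ m → ρ₁Of k m ≡ 1ℚ
  by-size (suc (suc k)) .(suc k) refl _ = 1+k/1+k≡1 k

ρ₁≤⇒e-bound : ∀ q {a} → ↥ q ≡ ℤ.+ a → ∀ G → ρ₁ G ℚ.≤ q → e G * ↧ₙ q ≤ a * (n G ∸ 1)
ρ₁≤⇒e-bound q {a} ↥q≡a G ρ₁≤q = by-size (n G) (e G) (e≡0-≤1 G) (subst (ℚ._≤ q) (ρ₁≡ρ₁Of G) ρ₁≤q)
  where
  by-size : ∀ k m → (k ≤ 1 → m ≡ 0) → ρ₁Of k m ℚ.≤ q → m * ↧ₙ q ≤ a * (k ∸ 1)
  by-size zero m small _ rewrite small z≤n = z≤n
  by-size (suc zero) m small _ rewrite small ≤-refl = z≤n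
  by-size (suc (suc k)) zero _ _ = z≤n
  by-size (suc (suc k)) (suc m) _ ρ₁≤q = /1+≤⁻ {suc m} {k} q ↥q≡a ρ₁≤q

e-bound⇒ρ₁≤ : ∀ q {a} → ↥ q ≡ ℤ.+ a → ∀ G → e G * ↧ₙ q ≤ a * (n G ∸ 1) → ρ₁ G ℚ.≤ q
e-bound⇒ρ₁≤ q {a} ↥q≡a G bound = subst (ℚ._≤ q) (sym (ρ₁≡ρ₁Of G)) (by-size (n G) (e G) bound)
  where
  by-size : ∀ k m → m * ↧ₙ q ≤ a * (k ∸ 1) → ρ₁Of k m ℚ.≤ q
  by-size zero m _ = /1+≤⁺ {0} {0} q ↥q≡a z≤n
  by-size (suc zero) m _ = /1+≤⁺ {0} {0} q ↥q≡a z≤n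
  by-size (suc (suc k)) zero _ = /1+≤⁺ {0} {0} q ↥q≡a z≤n
  by-size (suc (suc k)) (suc m) bound = /1+≤⁺ {suc m} {k} q ↥q≡a bound

3/2≤q⇒q≥1 : ∀ q → 3 /1+ 1 ℚ.≤ q → ∃[ a ] (↥ q ≡ ℤ.+ a × ↧ₙ q ≤ a)
3/2≤q⇒q≥1 q 3/2≤q with ↥ q in ↥q | /1+≤-cross {3} {1} q 3/2≤q
... | ℤ.+ a | cross = a , refl , *-cancelʳ-≤ (↧ₙ q) a 2 (≤-trans (≤-reflexive (*-comm (↧ₙ q) 2)) (≤-trans (*-monoˡ-≤ (↧ₙ q) (n≤1+n 2)) 3↧q≤2a))
  where
  3↧q≤2a : 3 * ↧ₙ q ≤ a * 2
  3↧q≤2a = ℤP.drop‿+≤+ (subst₂ ℤ._≤_ (sym (ℤP.pos-* 3 (↧ₙ q))) (sym (ℤP.pos-* a 2)) cross)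
... | -[1+ _ ] | ()

module AddableMinorClosed (A : Class) (minorClosed : MinorClosed A) (addable : Addable A)
                          (G₀ : Graph) (G₀∈A : A G₀) (v₀ : Fin (n G₀)) where
  open Amplification A minorClosed addable G₀ G₀∈A v₀
  open ForestsInClass A minorClosed addable G₀ G₀∈A v₀

  sameSup-density-ρ₁ : SameSup A A density ρ₁
  sameSup-density-ρ₁ q = density-bound⇒ρ₁-bound q , ρ₁-bound⇒density-bound A q

  module WithoutTriangle (K₃∉A : ¬ A (K 3)) where
    no-twoConnected : ∀ H → A H → ¬ TwoConnected H
    no-twoConnected H H∈A tc = K₃∉A (minorClosed H (K 3) H∈A (cycle⇒K3≼ H (twoConnected⇒cycle H tc)))

    A≡forests : ∀ G → (A G → Forest G) × (Forest G → A G)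
    A≡forests G = (λ G∈A cycle → K₃∉A (minorClosed G (K 3) G∈A (cycle⇒K3≼ G cycle))) , forest∈A G

    e≤n∸1 : ∀ G → A G → e G ≤ n G ∸ 1
    e≤n∸1 G G∈A = subst₂ _≤_ (*-identityʳ (e G)) (*-identityˡ (n G ∸ 1))
      (EdgeBound.e-bound A minorClosed 1 1 ≤-refl (λ H H∈A tc → ⊥-elim (no-twoConnected H H∈A tc)) G G∈A)

    β≡1 : β≡ A 1ℚ
    β≡1 = (λ G G∈A → e≤n∸1⇒density≤1 G (e≤n∸1 G G∈A)) ,
          (λ q q<1 → <ρ₁⇒<density q K₂ K₂∈A q<1)

    trees-ρ₁≡1 : ∀ T → A T → Connected T → 1 ≤ e T → ρ₁ T ≡ 1ℚ
    trees-ρ₁≡1 T T∈A con = e≡n∸1⇒ρ₁≡1 T (≤-antisym (e≤n∸1 T T∈A) (TreeBound.n∸1≤e A minorClosed no-twoConnected T T∈A con))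

  sameSup-twoConnected : A (K 3) → SameSup A (λ G → A G × TwoConnected G) density ρ₁
  sameSup-twoConnected K₃∈A q = (λ bound G → density-bound⇒ρ₁-bound q bound G ∘ proj₁) , ρ₁-bound⇒density-bound A q ∘ lift
    where
    -- Since K₃ is 2-connected, q ≥ 3/2; in particular q ≥ 1, as the graphs on at most two vertices require.
    lift : UpperBound (λ G → A G × TwoConnected G) ρ₁ q → UpperBound A ρ₁ q
    lift bound with 3/2≤q⇒q≥1 q (bound (K 3) (K₃∈A , K₃-twoConnected))
    ... | a , ↥q≡a , ↧q≤a = λ G G∈A → e-bound⇒ρ₁≤ q ↥q≡a G (EdgeBound.e-bound A minorClosed a (↧ₙ q) ↧q≤a
                              (λ H H∈A tc → ρ₁≤⇒e-bound q ↥q≡a H (bound H (H∈A , tc))) G G∈A)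

proposition6 : (A : Class) → MinorClosed A → Addable A →
    (∃[ G ] (A G × 1 ≤ v G)) →
    SameSup A A density ρ₁
    × (¬ A (K 3) →
         (∀ G → (A G → Forest G) × (Forest G → A G))
         × β≡ A 1ℚ
         × (∀ T → A T → Connected T → 1 ≤ e T → ρ₁ T ≡ 1ℚ))
    × (A (K 3) →
         SameSup A (λ G → A G × TwoConnected G) density ρ₁)
proposition6 A minorClosed addable (G₀ , G₀∈A , 1≤n) =
  sameSup-density-ρ₁ , (λ K₃∉A → let open WithoutTriangle K₃∉A in A≡forests , β≡1 , trees-ρ₁≡1) , sameSup-twoConnected
  where
  open AddableMinorClosed A minorClosed addable G₀ G₀∈A (fromℕ< 1≤n)
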